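{- Let $k \geq 2$ be an integer and let $G$ be an outerplanar graph with $n = 5k+1$ vertices. Then $G$ has a secure dominating set of size $\frac{n+4}{5} = k+1$ if and only if $G$ contains a spanning subgraph isomorphic to the graph $G_{k}$ defined as follows: \[ V(G_{k}) = \{v, v_{1}, \dots, v_{k}\} \cup \{w_{1}, \dots, w_{2k}\} \cup \{u_{i}^{1}, u_{i}^{2} \mid i = 1,\dots,k\}, \] \[ E(G_{k}) = \{v w_{i} \mid 1 \le i \le 2k\} \cup \{v_{i} w_{2i-1}, v_{i} w_{2i} \mid 1 \le i \le k\} \cup \{v_{i}u_{i}^{1}, v_{i}u_{i}^{2}, u_{i}^{1}u_{i}^{2} \mid 1 \le i \le k\}. \]
   Context: All graphs are finite, simple and undirected. A graph is outerplanar if it has a crossing-free embedding in the plane such that all vertices lie on the boundary of the outer (unbounded) face. A set $S \subseteq V(G)$ is a dominating set if every vertex not in $S$ is adjacent to some vertex of $S$. A dominating set $S$ is a secure dominating set if for every vertex $u \in V(G)\setminus S$ there exists a vertex $v \in S$ with $uv \in E(G)$ such that $(S \setminus \{v\}) \cup \{u\}$ is also a dominating set of $G$. A spanning subgraph of $G$ is a subgraph containing all vertices of $G$. -}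

module Defs where

open import Data.Nat using (ℕ; _<_)
open import Data.Bool using (Bool; true; false)
open import Data.Fin using (Fin; toℕ)
open import Data.Fin.Subset using (Subset; _∈_; _∉_; _∪_; _-_; ⁅_⁆)
open import Data.Product using (Σ; ∃; _×_; _,_)
open import Data.Sum using (_⊎_)
open import Relation.Nullary using (¬_)
open import Relation.Binary.PropositionalEquality using (_≡_)
open import Function.Bundles using (_↔_; Inverse; _⇔_)

record Graph (n : ℕ) : Set where
  field
    E    : Fin n → Fin n → Bool
    sym  : ∀ x y → E x y ≡ E y x
    irr  : ∀ x → E x x ≡ false

open Graph public

Adj : ∀ {n} → Graph n → Fin n → Fin n → Set
Adj G x y = E G x y ≡ true

-- Outerplanar: the vertices can be placed in convex position on a circle
-- (in the cyclic order given by the bijection `pos`) so that no two edges,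
-- drawn as straight chords, cross. (Combinatorial form of an outerplanar
-- embedding: all vertices on the outer face, no crossings.)
Outerplanar : ∀ {n} → Graph n → Set
Outerplanar {n} G =
  Σ (Fin n ↔ Fin n) λ pos →
    let p : Fin n → ℕ
        p x = toℕ (Inverse.to pos x)
    in ∀ a b c d → Adj G a b → Adj G c d →
         ¬ (p a < p c × p c < p b × p b < p d)

Dominating : ∀ {n} → Graph n → Subset n → Set
Dominating G S = ∀ u → u ∉ S → ∃ λ v → v ∈ S × Adj G u v

SecureDominating : ∀ {n} → Graph n → Subset n → Set
SecureDominating G S =
  Dominating G S ×
  (∀ u → u ∉ S → ∃ λ v → v ∈ S × Adj G u v × Dominating G ((S - v) ∪ ⁅ u ⁆))

-- Vertices of G_k:  c = v,  vv i = v_{i+1},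
--   w i 0 = w_{2i+1}, w i 1 = w_{2i+2}   (0-indexed i : Fin k),
--   u i 0 = u_{i+1}^1, u i 1 = u_{i+1}^2.
data GkV (k : ℕ) : Set where
  c  : GkV k
  vv : Fin k → GkV k
  w  : Fin k → Fin 2 → GkV k
  u  : Fin k → Fin 2 → GkV k

data GkEdge {k : ℕ} : GkV k → GkV k → Set where
  c-w : ∀ i j → GkEdge c (w i j)
  v-w : ∀ i j → GkEdge (vv i) (w i j)
  v-u : ∀ i j → GkEdge (vv i) (u i j)
  u-u : ∀ i → GkEdge (u i Fin.zero) (u i (Fin.suc Fin.zero))

GkAdj : ∀ {k} → GkV k → GkV k → Set
GkAdj x y = GkEdge x y ⊎ GkEdge y x

SpanningSubgraph : ∀ {n} → Graph n → Graph n → Set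
SpanningSubgraph H G = ∀ x y → Adj H x y → Adj G x y

IsoToGk : ∀ {n} → Graph n → (k : ℕ) → Set
IsoToGk {n} H k =
  Σ (GkV k ↔ Fin n) λ f →
    ∀ x y → GkAdj x y ⇔ Adj H (Inverse.to f x) (Inverse.to f y)

ContainsSpanningGk : ∀ {n} → Graph n → ℕ → Set
ContainsSpanningGk {n} G k =
  Σ (Graph n) λ H → SpanningSubgraph H G × IsoToGk H k

module Submission where

-- Let S be a secure dominating set with |S| = k + 1, so that 4k vertices lie outside S; call such a
-- vertex unshared if it has exactly one neighbour in S (it is then a private neighbour of that
-- vertex) and shared otherwise. Secure domination makes the private neighbours of each s ∈ S a
-- clique and puts them next to every shared vertex that s defends. Since an outerplanar graph
-- contains neither K₄ nor K₂,₃, every s has at most two private neighbours, and a defender of a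
-- shared vertex has at most one, in which case it defends at most two shared vertices. Outerplanarity
-- also bounds the number of shared vertices by 2|S| − 2.
-- If some s₀ ∈ S has no private neighbour, these bounds are tight: every other vertex of S has two
-- adjacent private neighbours, and every shared vertex is adjacent to s₀ and to one other vertex of
-- S, which receives exactly two of them. This is G_k. If every vertex of S has a private neighbour,
-- the count forces k = 2, and the vertices of S that defend two shared vertices each, together with
-- the third vertex of S, span a subdivided K₂,₃.
-- Conversely, the centre of G_k together with v₁, …, v_k is a secure dominating set.

module Counting where

  open import Data.Nat using (ℕ; zero; suc; _+_; _*_; _≤_; _<_; _≤ᵇ_; z≤n; s≤s)
  open import Data.Nat.Properties hiding (_≟_; suc-injective)
  open import Algebra.Properties.Semiring.Sum +-*-semiring
    using (sum; sum-remove; sum-replicate-zero; sum-cong-≗; ∑-distrib-+; ∑-comm; *-distribˡ-sum)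
  open import Data.Fin using (Fin; zero; suc; punchIn; _≟_)
  open import Data.Fin.Properties using (injective⇒≤; punchInᵢ≢i; suc-injective; any?)
  open import Data.Fin.Subset using (Subset; ∣_∣)
  open import Data.Vec using ([]; _∷_; lookup)
  open import Data.Bool as Bool using (Bool; true; false; not; _∧_; if_then_else_; T)
  open import Data.Bool.Properties using (∧-zeroʳ; ∧-identityʳ; ¬-not; T-≡)
  open import Function.Bundles using (Equivalence)
  open import Data.Product using (Σ; ∃; _×_; _,_; proj₁; proj₂)
  open import Data.Sum using (_⊎_; inj₁; inj₂; [_,_]′)
  open import Data.Empty using (⊥; ⊥-elim)
  open import Function using (_∘_; id; _⟨_⟩_)
  open import Function.Definitions using (Injective)
  open import Relation.Nullary using (yes; no; does)
  open import Relation.Binary.PropositionalEquality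

  private
    variable
      n r : ℕ

  ∧-elim : ∀ {a b} → a ∧ b ≡ true → a ≡ true × b ≡ true
  ∧-elim {true} b≡true = refl , b≡true

  ∧-intro : ∀ {a b} → a ≡ true → b ≡ true → a ∧ b ≡ true
  ∧-intro refl refl = refl

  not-elim : ∀ {a} → not a ≡ true → a ≡ false
  not-elim {false} _ = refl

  not-intro : ∀ {a} → a ≡ false → not a ≡ true
  not-intro refl = refl

  ≤ᵇ-elim : ∀ {m n} → (m ≤ᵇ n) ≡ true → m ≤ n
  ≤ᵇ-elim {m} {n} m≤ᵇn = ≤ᵇ⇒≤ m n (subst T (sym m≤ᵇn) _)

  ≤ᵇ-intro : ∀ {m n} → m ≤ n → (m ≤ᵇ n) ≡ true
  ≤ᵇ-intro m≤n = Equivalence.to T-≡ (≤⇒≤ᵇ m≤n)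

  ≤ᵇ-false : ∀ {m n} → (m ≤ᵇ n) ≡ false → n < m
  ≤ᵇ-false {m} {n} m≰ᵇn = ≰⇒> (λ m≤n → subst T m≰ᵇn (≤⇒≤ᵇ m≤n))

  distinguishes : (P : Fin n → Bool) {x y : Fin n} → P x ≡ true → P y ≡ false → x ≢ y
  distinguishes P Px ¬Py refl with () ← trans (sym Px) ¬Py

  sum-zero : {f : Fin n → ℕ} → (∀ i → f i ≡ 0) → sum f ≡ 0
  sum-zero {n} f≡0 = trans (sum-cong-≗ f≡0) (sum-replicate-zero n)

  sum-single : ∀ (f : Fin n → ℕ) j → (∀ i → i ≢ j → f i ≡ 0) → sum f ≡ f j
  sum-single {suc n} f j others≡0 = begin
    sum f                          ≡⟨ sum-remove f ⟩
    f j + sum (f ∘ punchIn j)      ≡⟨ cong (f j +_) (sum-zero (λ i → others≡0 _ (punchInᵢ≢i j i))) ⟩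
    f j + 0                        ≡⟨ +-identityʳ (f j) ⟩
    f j                            ∎
    where open ≡-Reasoning

  sum-mono-≤ : {f g : Fin n → ℕ} → (∀ i → f i ≤ g i) → sum f ≤ sum g
  sum-mono-≤ {zero}  f≤g = z≤n
  sum-mono-≤ {suc n} f≤g = +-mono-≤ (f≤g zero) (sum-mono-≤ (f≤g ∘ suc))

  sum-mono-< : {f g : Fin n → ℕ} → (∀ i → f i ≤ g i) → ∀ j → f j < g j → sum f < sum g
  sum-mono-< f≤g zero    fj<gj = +-mono-<-≤ fj<gj (sum-mono-≤ (f≤g ∘ suc))
  sum-mono-< f≤g (suc j) fj<gj = +-mono-≤-< (f≤g zero) (sum-mono-< (f≤g ∘ suc) j fj<gj)

  sum-tight : {f g : Fin n → ℕ} → (∀ i → f i ≤ g i) → sum g ≤ sum f → ∀ i → f i ≡ g i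
  sum-tight f≤g g≤f i with m≤n⇒m<n∨m≡n (f≤g i)
  ... | inj₁ fi<gi = ⊥-elim (<⇒≱ (sum-mono-< f≤g i fi<gi) g≤f)
  ... | inj₂ fi≡gi = fi≡gi

  ind : Bool → ℕ
  ind b = if b then 1 else 0

  count : (Fin n → Bool) → ℕ
  count P = sum (ind ∘ P)

  count-cong : {P Q : Fin n → Bool} → (∀ x → P x ≡ Q x) → count P ≡ count Q
  count-cong P≗Q = sum-cong-≗ (cong ind ∘ P≗Q)

  count-mono : {P Q : Fin n → Bool} → (∀ x → P x ≡ true → Q x ≡ true) → count P ≤ count Q
  count-mono P⊆Q = sum-mono-≤ (λ x → ind-mono (P⊆Q x))
    where
    ind-mono : ∀ {a b} → (a ≡ true → b ≡ true) → ind a ≤ ind b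
    ind-mono {false} _   = z≤n
    ind-mono {true}  a⇒b rewrite a⇒b refl = ≤-refl

  count-none : {P : Fin n → Bool} → (∀ x → P x ≡ false) → count P ≡ 0
  count-none P≡false = sum-zero (cong ind ∘ P≡false)

  count-split : (P Q : Fin n → Bool) →
                count P ≡ count (λ x → P x ∧ Q x) + count (λ x → P x ∧ not (Q x))
  count-split P Q =
    trans (sum-cong-≗ (λ x → ind-split (P x) (Q x))) (∑-distrib-+ (λ x → ind (P x ∧ Q x)) (λ x → ind (P x ∧ not (Q x))))
    where
    ind-split : ∀ a b → ind a ≡ ind (a ∧ b) + ind (a ∧ not b)
    ind-split true  true  = refl
    ind-split true  false = refl
    ind-split false _     = refl

  count-complement : (P : Fin n → Bool) → count P + count (not ∘ P) ≡ n
  count-complement {n} P = begin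
    count P + count (not ∘ P)   ≡⟨ count-split (λ _ → true) P ⟨
    count {n} (λ _ → true)      ≡⟨ count-all n ⟩
    n                           ∎
    where
    open ≡-Reasoning
    count-all : ∀ n → count {n} (λ _ → true) ≡ n
    count-all zero    = refl
    count-all (suc n) = cong suc (count-all n)

  count-scale : ∀ c (P : Fin n → Bool) {m} → count P ≡ m → sum (λ x → c * ind (P x)) ≡ c * m
  count-scale c P #P = trans (sym (*-distribˡ-sum c (ind ∘ P))) (cong (c *_) #P)

  sum-tight-at : ∀ c (P : Fin n → Bool) {f : Fin n → ℕ} → (∀ x → f x ≤ c * ind (P x)) → c * count P ≤ sum f →
                 ∀ {x} → P x ≡ true → f x ≡ c
  sum-tight-at c P {f} f≤ c·#P≤∑f {x} Px =
    trans (sum-tight f≤ (subst (_≤ sum f) (sym (count-scale c P refl)) c·#P≤∑f) x)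
          (trans (cong (λ b → c * ind b) Px) (*-identityʳ c))

  ∣_∣≡count : (D : Subset n) → ∣ D ∣ ≡ count (lookup D)
  ∣ []        ∣≡count = refl
  ∣ true ∷ D  ∣≡count = cong suc ∣ D ∣≡count
  ∣ false ∷ D ∣≡count = ∣ D ∣≡count
  _==_ : Fin n → Fin n → Bool
  x == y = does (x ≟ y)

  ==-refl : (x : Fin n) → (x == x) ≡ true
  ==-refl x with x ≟ x
  ... | yes _   = refl
  ... | no x≢x = ⊥-elim (x≢x refl)

  ==-≢ : {x y : Fin n} → x ≢ y → (x == y) ≡ false
  ==-≢ {x = x} {y} x≢y with x ≟ y
  ... | yes x≡y = ⊥-elim (x≢y x≡y)
  ... | no _    = refl

  ==-sound : {x y : Fin n} → (x == y) ≡ true → x ≡ y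
  ==-sound {x = x} {y} _ with x ≟ y
  ... | yes x≡y = x≡y

  count-fibres : ∀ {m} (P : Fin n → Bool) (f : Fin n → Fin m) →
                 sum (λ s → count (λ x → P x ∧ (f x == s))) ≡ count P
  count-fibres P f = trans (∑-comm (λ s x → ind (P x ∧ (f x == s)))) (sum-cong-≗ fibre)
    where
    fibre : ∀ x → sum (λ s → ind (P x ∧ (f x == s))) ≡ ind (P x)
    fibre x = begin
      sum (λ s → ind (P x ∧ (f x == s)))   ≡⟨ sum-single _ (f x) (λ s s≢fx → cong (λ b → ind (P x ∧ b)) (==-≢ (s≢fx ∘ sym))
                                                                              ⟨ trans ⟩ cong ind (∧-zeroʳ (P x))) ⟩
      ind (P x ∧ (f x == f x))             ≡⟨ cong (λ b → ind (P x ∧ b)) (==-refl (f x)) ⟩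
      ind (P x ∧ true)                     ≡⟨ cong ind (∧-identityʳ (P x)) ⟩
      ind (P x)                            ∎
      where open ≡-Reasoning

  _without_ : (Fin n → Bool) → Fin n → Fin n → Bool
  (P without s) x = P x ∧ not (x == s)

  without-∈ : {P : Fin n → Bool} {s x : Fin n} → P x ≡ true → x ≢ s → (P without s) x ≡ true
  without-∈ Px x≢s rewrite Px | ==-≢ x≢s = refl

  without-≢ : {P : Fin n → Bool} {s x : Fin n} → (P without s) x ≡ true → x ≢ s
  without-≢ {P = P} {x = x} h refl rewrite ==-refl x | ∧-zeroʳ (P x) with () ← h

  without-⊆ : {P : Fin n → Bool} {s x : Fin n} → (P without s) x ≡ true → P x ≡ true
  without-⊆ {P = P} {x = x} h with P x
  ... | true = refl

  count-remove : ∀ {n} (P : Fin n → Bool) {s : Fin n} → P s ≡ true → count P ≡ suc (count (P without s))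
  count-remove P {s} Ps = trans (count-split P (_== s)) (cong (_+ count (P without s)) single)
    where
    single : count (λ x → P x ∧ (x == s)) ≡ 1
    single = trans (sum-single _ s (λ x x≢s → cong (λ b → ind (P x ∧ b)) (==-≢ x≢s) ⟨ trans ⟩ cong ind (∧-zeroʳ (P x))))
                   (cong (λ b → ind (b ∧ (s == s))) Ps ⟨ trans ⟩ cong ind (==-refl s))

  search : (P : Fin n → Bool) → (∃ λ x → P x ≡ true) ⊎ (∀ x → P x ≡ false)
  search P with any? (λ x → P x Bool.≟ true)
  ... | yes found = inj₁ found
  ... | no none   = inj₂ (λ x → ¬-not (λ Px → none (x , Px)))

  record Enumerates {n r} (P : Fin n → Bool) (g : Fin r → Fin n) : Set where
    field
      injective : Injective _≡_ _≡_ g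
      inside    : ∀ i → P (g i) ≡ true
      onto      : ∀ x → P x ≡ true → ∃ λ i → g i ≡ x

  enumerate : (P : Fin n → Bool) → Σ (Fin (count P) → Fin n) (Enumerates P)
  enumerate {zero}  P = (λ ()) , record { injective = λ {} ; inside = λ () ; onto = λ () }
  enumerate {suc n} P with enumerate (P ∘ suc)
  ... | g , record { injective = g-inj ; inside = g-in ; onto = g-onto } with P zero in P0
  ...   | true  = g′ , record { injective = g′-inj ; inside = g′-in ; onto = g′-onto }
    where
    g′ : Fin (suc (count (P ∘ suc))) → Fin (suc n)
    g′ zero    = zero
    g′ (suc i) = suc (g i)
    g′-inj : Injective _≡_ _≡_ g′
    g′-inj {zero}  {zero}  _  = refl
    g′-inj {suc i} {suc j} eq = cong suc (g-inj (suc-injective eq))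
    g′-in : ∀ i → P (g′ i) ≡ true
    g′-in zero    = P0
    g′-in (suc i) = g-in i
    g′-onto : ∀ x → P x ≡ true → ∃ λ i → g′ i ≡ x
    g′-onto zero    _  = zero , refl
    g′-onto (suc x) Px = let i , gi≡x = g-onto x Px in suc i , cong suc gi≡x
  ...   | false = suc ∘ g , record { injective = g-inj ∘ suc-injective ; inside = g-in ; onto = g′-onto }
    where
    g′-onto : ∀ x → P x ≡ true → ∃ λ i → suc (g i) ≡ x
    g′-onto zero    Px with () ← trans (sym P0) Px
    g′-onto (suc x) Px = let i , gi≡x = g-onto x Px in i , cong suc gi≡x

  injective⇒≤count : (P : Fin n → Bool) {g : Fin r → Fin n} → Injective _≡_ _≡_ g →
                     (∀ i → P (g i) ≡ true) → r ≤ count P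
  injective⇒≤count P {g} g-inj g-in = injective⇒≤ h-inj
    where
    open Enumerates (proj₂ (enumerate P))
    h : Fin _ → Fin (count P)
    h i = proj₁ (onto (g i) (g-in i))
    h-inj : Injective _≡_ _≡_ h
    h-inj {i} {j} hi≡hj = g-inj (begin
      g i                          ≡⟨ proj₂ (onto (g i) (g-in i)) ⟨
      proj₁ (enumerate P) (h i)    ≡⟨ cong (proj₁ (enumerate P)) hi≡hj ⟩
      proj₁ (enumerate P) (h j)    ≡⟨ proj₂ (onto (g j) (g-in j)) ⟩
      g j                          ∎)
      where open ≡-Reasoning

  onto⇒count≤ : (P : Fin n → Bool) {g : Fin r → Fin n} → (∀ x → P x ≡ true → ∃ λ i → g i ≡ x) → count P ≤ r
  onto⇒count≤ P {g} g-onto = injective⇒≤ h-inj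
    where
    e = proj₁ (enumerate P)
    open Enumerates (proj₂ (enumerate P))
    h : Fin (count P) → Fin _
    h i = proj₁ (g-onto (e i) (inside i))
    h-inj : Injective _≡_ _≡_ h
    h-inj {i} {j} hi≡hj = injective (begin
      e i          ≡⟨ proj₂ (g-onto (e i) (inside i)) ⟨
      g (h i)      ≡⟨ cong g hi≡hj ⟩
      g (h j)      ≡⟨ proj₂ (g-onto (e j) (inside j)) ⟩
      e j          ∎)
      where open ≡-Reasoning

  Enumerates⇒count≡ : (P : Fin n → Bool) {g : Fin r → Fin n} → Enumerates P g → count P ≡ r
  Enumerates⇒count≡ P g-enum =
    ≤-antisym (onto⇒count≤ P onto) (injective⇒≤count P injective inside)
    where open Enumerates g-enum

  count≡⇒enumeration : (P : Fin n → Bool) → count P ≡ r → Σ (Fin r → Fin n) (Enumerates P)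
  count≡⇒enumeration P refl = enumerate P

  ≥1⇒∈ : (P : Fin n → Bool) → 1 ≤ count P → ∃ λ x → P x ≡ true
  ≥1⇒∈ P 1≤c = [ id , (λ none → ⊥-elim (<⇒≱ 1≤c (≤-reflexive (count-none none)))) ]′ (search P)

  ∈⇒≥1 : (P : Fin n → Bool) {x : Fin n} → P x ≡ true → 1 ≤ count P
  ∈⇒≥1 P Px rewrite count-remove P Px = s≤s z≤n

  ≥2⇒two : (P : Fin n → Bool) → 2 ≤ count P → ∃ λ x → ∃ λ y → x ≢ y × P x ≡ true × P y ≡ true
  ≥2⇒two P 2≤c =
    let x , Px = ≥1⇒∈ P (≤-trans (s≤s z≤n) 2≤c)
        y , h  = ≥1⇒∈ (P without x) (≤-pred (subst (2 ≤_) (count-remove P Px) 2≤c))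
    in x , y , without-≢ {P = P} h ∘ sym , Px , without-⊆ {P = P} h

  two⇒≥2 : (P : Fin n → Bool) {x y : Fin n} → x ≢ y → P x ≡ true → P y ≡ true → 2 ≤ count P
  two⇒≥2 P x≢y Px Py rewrite count-remove P Px = s≤s (∈⇒≥1 (P without _) (without-∈ {P = P} Py (x≢y ∘ sym)))

  ≥2⇒other : (P : Fin n → Bool) → 2 ≤ count P → ∀ z → ∃ λ t → P t ≡ true × t ≢ z
  ≥2⇒other P 2≤c z = other (≥2⇒two P 2≤c)
    where
    other : (∃ λ x → ∃ λ y → x ≢ y × P x ≡ true × P y ≡ true) → ∃ λ t → P t ≡ true × t ≢ z
    other (x , y , x≢y , Px , Py) with x ≟ z
    ... | yes refl = y , Py , x≢y ∘ sym
    ... | no x≢z   = x , Px , x≢z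

  ≥3⇒three : (P : Fin n → Bool) → 3 ≤ count P →
             ∃ λ x → ∃ λ y → ∃ λ z → x ≢ y × x ≢ z × y ≢ z × P x ≡ true × P y ≡ true × P z ≡ true
  ≥3⇒three P 3≤c =
    let x , Px = ≥1⇒∈ P (≤-trans (s≤s z≤n) 3≤c)
        y , z , y≢z , hy , hz = ≥2⇒two (P without x) (≤-pred (subst (3 ≤_) (count-remove P Px) 3≤c))
    in x , y , z , without-≢ {P = P} hy ∘ sym , without-≢ {P = P} hz ∘ sym , y≢z , Px , without-⊆ {P = P} hy , without-⊆ {P = P} hz

  three⇒≥3 : (P : Fin n → Bool) {x y z : Fin n} → x ≢ y → x ≢ z → y ≢ z →
             P x ≡ true → P y ≡ true → P z ≡ true → 3 ≤ count P
  three⇒≥3 P x≢y x≢z y≢z Px Py Pz rewrite count-remove P Px =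
    s≤s (two⇒≥2 (P without _) y≢z (without-∈ {P = P} Py (x≢y ∘ sym)) (without-∈ {P = P} Pz (x≢z ∘ sym)))

  NoThree : (Fin n → Bool) → Set
  NoThree P = ∀ {x y z} → x ≢ y → x ≢ z → y ≢ z → P x ≡ true → P y ≡ true → P z ≡ true → ⊥

  NoThree⇒≤2 : (P : Fin n → Bool) → NoThree P → count P ≤ 2
  NoThree⇒≤2 P no-three = ≮⇒≥ λ 2<c →
    let _ , _ , _ , x≢y , x≢z , y≢z , Px , Py , Pz = ≥3⇒three P 2<c in no-three x≢y x≢z y≢z Px Py Pz

  ≤2⇒NoThree : (P : Fin n → Bool) → count P ≤ 2 → NoThree P
  ≤2⇒NoThree P c≤2 x≢y x≢z y≢z Px Py Pz = <⇒≱ (s≤s c≤2) (three⇒≥3 P x≢y x≢z y≢z Px Py Pz)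

module ConvexPosition where

  open import Data.Nat using (ℕ; _<_)
  open import Data.Nat.Properties using (<-cmp; <-trans; <-asym)
  open import Data.Product using (_×_; _,_; proj₁; proj₂)
  open import Data.Sum using (_⊎_; inj₁; inj₂)
  open import Data.Empty using (⊥-elim)
  open import Function using (_∘_)
  open import Function.Bundles using (_⇔_; Equivalence)
  open import Relation.Nullary using (¬_)
  open import Relation.Binary using (tri<; tri≈; tri>)
  open import Relation.Binary.PropositionalEquality using (_≡_; _≢_; sym)

  open Equivalence using (to; from)

  Between : ℕ → ℕ → ℕ → Set
  Between a b x = (a < x × x < b) ⊎ (b < x × x < a)

  SameSide : ℕ → ℕ → ℕ → ℕ → Set
  SameSide a b x y = Between a b x ⇔ Between a b y

  between-sym : ∀ {a b x} → Between a b x → Between b a x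
  between-sym (inj₁ a<x<b) = inj₂ a<x<b
  between-sym (inj₂ b<x<a) = inj₁ b<x<a

  below⇒¬between : ∀ {a b x} → x < a → x < b → ¬ Between a b x
  below⇒¬between x<a _   (inj₁ (a<x , _)) = <-asym x<a a<x
  below⇒¬between _   x<b (inj₂ (b<x , _)) = <-asym x<b b<x

  ≢⇒<⊎> : ∀ {x y} → x ≢ y → x < y ⊎ y < x
  ≢⇒<⊎> {x} {y} x≢y with <-cmp x y
  ... | tri< x<y _ _ = inj₁ x<y
  ... | tri≈ _ x≡y _ = ⊥-elim (x≢y x≡y)
  ... | tri> _ _ y<x = inj₂ y<x

  ¬between⇒outside : ∀ {a b x} → a < b → x ≢ a → x ≢ b → ¬ Between a b x → x < a ⊎ b < x
  ¬between⇒outside {a} {b} {x} a<b x≢a x≢b ¬a<x<b with ≢⇒<⊎> x≢a | ≢⇒<⊎> x≢b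
  ... | inj₁ x<a | _        = inj₁ x<a
  ... | inj₂ _   | inj₂ b<x = inj₂ b<x
  ... | inj₂ a<x | inj₁ x<b = ⊥-elim (¬a<x<b (inj₁ (a<x , x<b)))

  Distinct5 : ℕ → ℕ → ℕ → ℕ → ℕ → Set
  Distinct5 a b c d z =
    a ≢ b × a ≢ c × a ≢ d × a ≢ z × b ≢ c × b ≢ d × b ≢ z × c ≢ d × c ≢ z × d ≢ z

  -- With the points on a circle cut open at 0, a side xy of the quadrilateral abcd separates the
  -- circle into the arcs "between x and y" and its complement; z is inside when it lies on the
  -- same arc as the opposite side, for every side.
  record Inside (a b c d z : ℕ) : Set where
    field
      ab-convex : SameSide a b c d
      ab-inside : SameSide a b c z
      bc-convex : SameSide b c d a
      bc-inside : SameSide b c d z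
      cd-convex : SameSide c d a b
      cd-inside : SameSide c d a z
      da-convex : SameSide d a b c
      da-inside : SameSide d a b z

  rotate : ∀ {a b c d z} → Inside a b c d z → Inside b c d a z
  rotate I = record
    { ab-convex = bc-convex ; ab-inside = bc-inside ; bc-convex = cd-convex ; bc-inside = cd-inside
    ; cd-convex = da-convex ; cd-inside = da-inside ; da-convex = ab-convex ; da-inside = ab-inside }
    where open Inside I

  rotate-distinct : ∀ {a b c d z} → Distinct5 a b c d z → Distinct5 b c d a z
  rotate-distinct (a≢b , a≢c , a≢d , a≢z , b≢c , b≢d , b≢z , c≢d , c≢z , d≢z) =
    b≢c , b≢d , a≢b ∘ sym , b≢z , c≢d , a≢c ∘ sym , c≢z , a≢d ∘ sym , d≢z , a≢z

  private
    ¬Inside-when-c<b : ∀ {a b c d z} → Distinct5 a b c d z → a < b → a < c → a < d → c < b → ¬ Inside a b c d z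
    ¬Inside-when-c<b {a} {b} {c} {d} {z} (_ , _ , _ , _ , _ , b≢d , b≢z , c≢d , c≢z , d≢z) a<b a<c a<d c<b I =
      ¬b∈da (from da-inside (inj₂ (a<z , z<d)))
      where
      open Inside I
      c∈ab = inj₁ (a<c , c<b)
      d<b : d < b
      d<b with to ab-convex c∈ab
      ... | inj₁ (_ , d<b) = d<b
      ... | inj₂ (_ , d<a) = ⊥-elim (<-asym d<a a<d)
      a<z<b : a < z × z < b
      a<z<b with to ab-inside c∈ab
      ... | inj₁ a<z<b = a<z<b
      ... | inj₂ (b<z , z<a) = ⊥-elim (<-asym (<-trans b<z z<a) a<b)
      a<z = proj₁ a<z<b
      d<c : d < c
      d<c with ¬between⇒outside c<b (c≢d ∘ sym) (b≢d ∘ sym)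
                 (below⇒¬between a<b a<c ∘ to bc-convex ∘ between-sym)
      ... | inj₁ d<c = d<c
      ... | inj₂ b<d = ⊥-elim (<-asym b<d d<b)
      z<c : z < c
      z<c with ¬between⇒outside c<b (c≢z ∘ sym) (b≢z ∘ sym)
                 (below⇒¬between a<b a<c ∘ to bc-convex ∘ from bc-inside ∘ between-sym)
      ... | inj₁ z<c = z<c
      ... | inj₂ b<z = ⊥-elim (<-asym b<z (proj₂ a<z<b))
      z<d : z < d
      z<d with ¬between⇒outside d<c (d≢z ∘ sym) (c≢z ∘ sym)
                 (below⇒¬between a<c a<d ∘ from cd-inside ∘ between-sym)
      ... | inj₁ z<d = z<d
      ... | inj₂ c<z = ⊥-elim (<-asym c<z z<c)
      ¬b∈da : ¬ Between d a b
      ¬b∈da (inj₁ (_ , b<a)) = <-asym b<a a<b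
      ¬b∈da (inj₂ (_ , b<d)) = <-asym b<d d<b

    ¬Inside-when-b<c : ∀ {a b c d z} → Distinct5 a b c d z → a < b → a < c → a < d → b < c → ¬ Inside a b c d z
    ¬Inside-when-b<c {a} {b} {c} {d} {z} (_ , _ , a≢d , a≢z , _ , b≢d , b≢z , _ , c≢z , _) a<b a<c a<d b<c I =
      below⇒¬between a<c a<d (from cd-inside (inj₁ (c<z , z<d)))
      where
      open Inside I
      ¬c∈ab : ¬ Between a b c
      ¬c∈ab (inj₁ (_ , c<b)) = <-asym c<b b<c
      ¬c∈ab (inj₂ (_ , c<a)) = <-asym c<a a<c
      b<d : b < d
      b<d with ¬between⇒outside a<b (a≢d ∘ sym) (b≢d ∘ sym) (¬c∈ab ∘ from ab-convex)
      ... | inj₁ d<a = ⊥-elim (<-asym d<a a<d)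
      ... | inj₂ b<d = b<d
      b∈da = inj₂ (a<b , b<d)
      c<d : c < d
      c<d with to da-convex b∈da
      ... | inj₁ (_ , c<a) = ⊥-elim (<-asym c<a a<c)
      ... | inj₂ (_ , c<d) = c<d
      a<z<d : a < z × z < d
      a<z<d with to da-inside b∈da
      ... | inj₁ (d<z , z<a) = ⊥-elim (<-asym (<-trans a<d d<z) z<a)
      ... | inj₂ a<z<d = a<z<d
      z<d = proj₂ a<z<d
      b<z : b < z
      b<z with ¬between⇒outside a<b (a≢z ∘ sym) (b≢z ∘ sym) (¬c∈ab ∘ from ab-inside)
      ... | inj₁ z<a = ⊥-elim (<-asym z<a (proj₁ a<z<d))
      ... | inj₂ b<z = b<z
      c<z : c < z
      c<z with ¬between⇒outside b<c (b≢z ∘ sym) (c≢z ∘ sym) (below⇒¬between a<b a<c ∘ to bc-convex ∘ from bc-inside)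
      ... | inj₁ z<b = ⊥-elim (<-asym z<b b<z)
      ... | inj₂ c<z = c<z

  ¬Inside-from-minimum : ∀ {a b c d z} → Distinct5 a b c d z → a < b → a < c → a < d → ¬ Inside a b c d z
  ¬Inside-from-minimum D@(_ , _ , _ , _ , b≢c , _) a<b a<c a<d with ≢⇒<⊎> b≢c
  ... | inj₁ b<c = ¬Inside-when-b<c D a<b a<c a<d b<c
  ... | inj₂ c<b = ¬Inside-when-c<b D a<b a<c a<d c<b

  minimum-of-four : ∀ {a b c d} → a ≢ b → a ≢ c → a ≢ d → b ≢ c → b ≢ d → c ≢ d →
                    (a < b × a < c × a < d) ⊎ (b < c × b < d × b < a) ⊎
                    (c < d × c < a × c < b) ⊎ (d < a × d < b × d < c)
  minimum-of-four a≢b a≢c a≢d b≢c b≢d c≢d with ≢⇒<⊎> a≢b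
  minimum-of-four a≢b a≢c a≢d b≢c b≢d c≢d | inj₁ a<b with ≢⇒<⊎> a≢c
  ... | inj₁ a<c with ≢⇒<⊎> a≢d
  ...   | inj₁ a<d = inj₁ (a<b , a<c , a<d)
  ...   | inj₂ d<a = inj₂ (inj₂ (inj₂ (d<a , <-trans d<a a<b , <-trans d<a a<c)))
  minimum-of-four a≢b a≢c a≢d b≢c b≢d c≢d | inj₁ a<b | inj₂ c<a with ≢⇒<⊎> c≢d
  ... | inj₁ c<d = inj₂ (inj₂ (inj₁ (c<d , c<a , <-trans c<a a<b)))
  ... | inj₂ d<c = inj₂ (inj₂ (inj₂ (<-trans d<c c<a , <-trans d<c (<-trans c<a a<b) , d<c)))
  minimum-of-four a≢b a≢c a≢d b≢c b≢d c≢d | inj₂ b<a with ≢⇒<⊎> b≢c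
  ... | inj₁ b<c with ≢⇒<⊎> b≢d
  ...   | inj₁ b<d = inj₂ (inj₁ (b<c , b<d , b<a))
  ...   | inj₂ d<b = inj₂ (inj₂ (inj₂ (<-trans d<b b<a , d<b , <-trans d<b b<c)))
  minimum-of-four a≢b a≢c a≢d b≢c b≢d c≢d | inj₂ b<a | inj₂ c<b with ≢⇒<⊎> c≢d
  ... | inj₁ c<d = inj₂ (inj₂ (inj₁ (c<d , <-trans c<b b<a , c<b)))
  ... | inj₂ d<c = inj₂ (inj₂ (inj₂ (<-trans d<c (<-trans c<b b<a) , <-trans d<c c<b , d<c)))

  ¬Inside : ∀ {a b c d z} → Distinct5 a b c d z → ¬ Inside a b c d z
  ¬Inside D@(a≢b , a≢c , a≢d , _ , b≢c , b≢d , _ , c≢d , _) I with minimum-of-four a≢b a≢c a≢d b≢c b≢d c≢d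
  ... | inj₁ (a<b , a<c , a<d) = ¬Inside-from-minimum D a<b a<c a<d I
  ... | inj₂ (inj₁ (b<c , b<d , b<a)) = ¬Inside-from-minimum (rotate-distinct D) b<c b<d b<a (rotate I)
  ... | inj₂ (inj₂ (inj₁ (c<d , c<a , c<b))) =
    ¬Inside-from-minimum (rotate-distinct (rotate-distinct D)) c<d c<a c<b (rotate (rotate I))
  ... | inj₂ (inj₂ (inj₂ (d<a , d<b , d<c))) =
    ¬Inside-from-minimum (rotate-distinct (rotate-distinct (rotate-distinct D))) d<a d<b d<c (rotate (rotate (rotate I)))

module OuterplanarDrawing where

  open import Defs using (Graph; Adj)
  open ConvexPosition
  open Counting
  open import Data.Nat using (ℕ; zero; suc; _+_; _*_; _∸_; _<_; _≤_; _<?_; _≤ᵇ_; s≤s; z≤n)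
  open import Data.Nat.Properties
    using ( ≤-refl; ≤-reflexive; ≤-trans; ≤-pred; <-trans; <-asym; <⇒≤; <⇒≱; ≰⇒>; suc-injective; module ≤-Reasoning
          ; +-assoc; +-mono-≤; +-monoˡ-≤; +-monoʳ-≤; *-suc; m<n⇒0<n∸m; ∸-monoˡ-≤; ∸-monoʳ-≤; ∸-monoˡ-<; ∸-monoʳ-< )
  open import Data.Fin using (Fin; _≟_)
  open import Data.Bool using (Bool; true; false; not; _∧_)
  open import Data.Bool.Properties using (∧-zeroʳ; ∧-identityʳ)
  open import Data.Product using (∃; _×_; _,_; proj₁; proj₂)
  open import Data.Sum using (_⊎_; inj₁; inj₂; [_,_]′)
  open import Data.Empty using (⊥; ⊥-elim)
  open import Function using (_∘_)
  open import Function.Bundles using (_⇔_; mk⇔; Equivalence)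
  open import Function.Definitions using (Injective)
  import Function.Properties.Equivalence as ⇔
  open import Relation.Nullary using (¬_; Dec; yes; no; _×-dec_; _⊎-dec_)
  open import Relation.Binary.PropositionalEquality

  NonCrossing : ∀ {n} → Graph n → (Fin n → ℕ) → Set
  NonCrossing G p = ∀ a b c d → Adj G a b → Adj G c d → ¬ (p a < p c × p c < p b × p b < p d)

  between? : ∀ a b x → Dec (Between a b x)
  between? a b x = (a <? x ×-dec x <? b) ⊎-dec (b <? x ×-dec x <? a)

  module NonCrossingDrawing {n} (G : Graph n) (p : Fin n → ℕ) (p-injective : Injective _≡_ _≡_ p)
                            (no-crossing : NonCrossing G p) where

    adj-sym : ∀ {a b} → Adj G a b → Adj G b a
    adj-sym {a} {b} = trans (Graph.sym G b a)

    adj⇒≢ : ∀ {a b} → Adj G a b → a ≢ b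
    adj⇒≢ {a} ab refl with () ← trans (sym ab) (Graph.irr G a)

    p-≢ : ∀ {x y} → x ≢ y → p x ≢ p y
    p-≢ x≢y = x≢y ∘ p-injective

    cross : ∀ {a b c d} → Adj G a b → Adj G c d → p a < p c → p c < p b → p b < p d → ⊥
    cross ab cd a<c c<b b<d = no-crossing _ _ _ _ ab cd (a<c , c<b , b<d)

    Btw : Fin n → Fin n → Fin n → Set
    Btw a b x = Between (p a) (p b) (p x)

    btw? : ∀ a b x → Dec (Btw a b x)
    btw? a b x = between? (p a) (p b) (p x)

    neighbour-inside : ∀ {x y z t} → Adj G x y → p x < p z → p z < p y → Adj G z t → t ≢ x → t ≢ y →
                       p x < p t × p t < p y
    neighbour-inside xy x<z z<y zt t≢x t≢y with ≢⇒<⊎> (p-≢ t≢x) | ≢⇒<⊎> (p-≢ t≢y)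
    ... | inj₁ t<x | _        = ⊥-elim (cross (adj-sym zt) xy t<x x<z z<y)
    ... | inj₂ _   | inj₂ y<t = ⊥-elim (cross xy zt x<z z<y y<t)
    ... | inj₂ x<t | inj₁ t<y = x<t , t<y

    neighbour-within : ∀ {x y z t} → Adj G x y → p x < p y → p x < p z → p z < p y → Adj G z t →
                       p x ≤ p t × p t ≤ p y
    neighbour-within {x} {y} {z} {t} xy x<y x<z z<y zt with t ≟ x | t ≟ y
    ... | yes refl | _        = ≤-refl , <⇒≤ x<y
    ... | no _     | yes refl = <⇒≤ x<y , ≤-refl
    ... | no t≢x   | no t≢y   = let x<t , t<y = neighbour-inside xy x<z z<y zt t≢x t≢y in <⇒≤ x<t , <⇒≤ t<y

    edge-same-side : ∀ {a b v w} → Adj G a b → Adj G v w → v ≢ a → v ≢ b → w ≢ a → w ≢ b → Btw a b v → Btw a b w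
    edge-same-side {a} {b} {v} {w} ab vw v≢a v≢b w≢a w≢b v∈ab with btw? a b w
    ... | yes w∈ab = w∈ab
    ... | no w∉ab with v∈ab
    ...   | inj₁ (a<v , v<b) with ¬between⇒outside (<-trans a<v v<b) (p-≢ w≢a) (p-≢ w≢b) w∉ab
    ...     | inj₁ w<a = ⊥-elim (cross (adj-sym vw) ab w<a a<v v<b)
    ...     | inj₂ b<w = ⊥-elim (cross ab vw a<v v<b b<w)
    edge-same-side {a} {b} {v} {w} ab vw v≢a v≢b w≢a w≢b v∈ab | no w∉ab | inj₂ (b<v , v<a)
      with ¬between⇒outside (<-trans b<v v<a) (p-≢ w≢b) (p-≢ w≢a) (w∉ab ∘ between-sym)
    ... | inj₁ w<b = ⊥-elim (cross (adj-sym vw) (adj-sym ab) w<b b<v v<a)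
    ... | inj₂ a<w = ⊥-elim (cross (adj-sym ab) vw b<v v<a a<w)

    edge-on-one-side : ∀ {a b v w} → Adj G a b → Adj G v w → v ≢ a → v ≢ b → w ≢ a → w ≢ b →
                       SameSide (p a) (p b) (p v) (p w)
    edge-on-one-side ab vw v≢a v≢b w≢a w≢b =
      mk⇔ (edge-same-side ab vw v≢a v≢b w≢a w≢b) (edge-same-side ab (adj-sym vw) w≢a w≢b v≢a v≢b)

    Common : Fin n → Fin n → Fin n → Set
    Common s t u = Adj G s u × Adj G t u

    private
      inside-inside : ∀ {s t u w} → Adj G s u → Adj G t u → Adj G s w → Adj G t w → u ≢ w →
                      p s < p u → p u < p t → p s < p w → p w < p t → ⊥
      inside-inside su tu sw tw u≢w s<u u<t s<w w<t with ≢⇒<⊎> (p-≢ u≢w)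
      ... | inj₁ u<w = cross sw (adj-sym tu) s<u u<w w<t
      ... | inj₂ w<u = cross su (adj-sym tw) s<w w<u u<t

      outside-outside : ∀ {s t u w} → Adj G s u → Adj G t u → Adj G s w → Adj G t w → u ≢ w → p s < p t →
                        p u < p s ⊎ p t < p u → p w < p s ⊎ p t < p w → ⊥
      outside-outside su tu sw tw u≢w s<t (inj₁ u<s) (inj₂ t<w) = cross (adj-sym tu) sw u<s s<t t<w
      outside-outside su tu sw tw u≢w s<t (inj₂ t<u) (inj₁ w<s) = cross (adj-sym tw) su w<s s<t t<u
      outside-outside su tu sw tw u≢w s<t (inj₁ u<s) (inj₁ w<s) with ≢⇒<⊎> (p-≢ u≢w)
      ... | inj₁ u<w = cross (adj-sym su) (adj-sym tw) u<w w<s s<t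
      ... | inj₂ w<u = cross (adj-sym sw) (adj-sym tu) w<u u<s s<t
      outside-outside su tu sw tw u≢w s<t (inj₂ t<u) (inj₂ t<w) with ≢⇒<⊎> (p-≢ u≢w)
      ... | inj₁ u<w = cross su tw s<t t<u u<w
      ... | inj₂ w<u = cross sw tu s<t t<w w<u

      separated-ordered : ∀ {s t u w} → p s < p t → Common s t u → Common s t w → u ≢ w →
                          ¬ SameSide (p s) (p t) (p u) (p w)
      separated-ordered {s} {t} {u} {w} s<t (su , tu) (sw , tw) u≢w same with btw? s t u
      ... | yes u∈st with u∈st | Equivalence.to same u∈st
      ...   | inj₂ (t<u , u<s) | _ = <-asym s<t (<-trans t<u u<s)
      ...   | inj₁ _ | inj₂ (t<w , w<s) = <-asym s<t (<-trans t<w w<s)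
      ...   | inj₁ (s<u , u<t) | inj₁ (s<w , w<t) = inside-inside su tu sw tw u≢w s<u u<t s<w w<t
      separated-ordered {s} {t} {u} {w} s<t (su , tu) (sw , tw) u≢w same | no u∉st =
        outside-outside su tu sw tw u≢w s<t (outside u∉st (adj⇒≢ su ∘ sym) (adj⇒≢ tu ∘ sym))
                                             (outside (u∉st ∘ Equivalence.from same) (adj⇒≢ sw ∘ sym) (adj⇒≢ tw ∘ sym))
        where
        outside : ∀ {x} → ¬ Btw s t x → x ≢ s → x ≢ t → p x < p s ⊎ p t < p x
        outside x∉st x≢s x≢t = ¬between⇒outside s<t (p-≢ x≢s) (p-≢ x≢t) x∉st

    common-neighbours-separated : ∀ {s t u w} → s ≢ t → Common s t u → Common s t w → u ≢ w →
                                  ¬ SameSide (p s) (p t) (p u) (p w)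
    common-neighbours-separated {s} {t} s≢t cu cw u≢w with ≢⇒<⊎> (p-≢ s≢t)
    ... | inj₁ s<t = separated-ordered s<t cu cw u≢w
    ... | inj₂ t<s = separated-ordered t<s (swap cu) (swap cw) u≢w ∘ flip
      where
      swap : ∀ {x} → Common s t x → Common t s x
      swap (sx , tx) = tx , sx
      flip : ∀ {a b x y} → SameSide a b x y → SameSide b a x y
      flip same = mk⇔ (between-sym ∘ Equivalence.to same ∘ between-sym) (between-sym ∘ Equivalence.from same ∘ between-sym)

    private
      separated : ∀ {s t u w} → s ≢ t → Common s t u → Common s t w → u ≢ w → Btw s t u → Btw s t w → ⊥
      separated s≢t cu cw u≢w u∈ w∈ = common-neighbours-separated s≢t cu cw u≢w (mk⇔ (λ _ → w∈) (λ _ → u∈))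

      separated′ : ∀ {s t u w} → s ≢ t → Common s t u → Common s t w → u ≢ w → ¬ Btw s t u → ¬ Btw s t w → ⊥
      separated′ s≢t cu cw u≢w u∉ w∉ = common-neighbours-separated s≢t cu cw u≢w (mk⇔ (⊥-elim ∘ u∉) (⊥-elim ∘ w∉))

    no-K₂₃ : ∀ {s t u v w} → s ≢ t → Common s t u → Common s t v → Common s t w → u ≢ v → u ≢ w → v ≢ w → ⊥
    no-K₂₃ {s} {t} {u} {v} {w} s≢t cu cv cw u≢v u≢w v≢w with btw? s t u | btw? s t v | btw? s t w
    ... | yes u∈ | yes v∈ | _      = separated s≢t cu cv u≢v u∈ v∈
    ... | yes u∈ | no _   | yes w∈ = separated s≢t cu cw u≢w u∈ w∈
    ... | yes _  | no v∉  | no w∉  = separated′ s≢t cv cw v≢w v∉ w∉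
    ... | no u∉  | no v∉  | _      = separated′ s≢t cu cv u≢v u∉ v∉
    ... | no u∉  | yes _  | no w∉  = separated′ s≢t cu cw u≢w u∉ w∉
    ... | no _   | yes v∈ | yes w∈ = separated s≢t cv cw v≢w v∈ w∈

    no-K₄ : ∀ {s t u w} → Adj G s t → Common s t u → Common s t w → Adj G u w → ⊥
    no-K₄ st cu@(su , tu) cw@(sw , tw) uw =
      common-neighbours-separated (adj⇒≢ st) cu cw (adj⇒≢ uw)
        (edge-on-one-side st uw (adj⇒≢ su ∘ sym) (adj⇒≢ tu ∘ sym) (adj⇒≢ sw ∘ sym) (adj⇒≢ tw ∘ sym))

    -- The paths s₁xs₂, s₁ys₂ and s₁x′s₃y′s₂ form a subdivided K₂,₃; the third one keeps s₃ on the
    -- inner side of every side of the quadrilateral s₁xs₂y.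
    no-θ : ∀ {s₁ s₂ s₃ x y x′ y′} →
           Adj G s₁ x → Adj G x s₂ → Adj G s₂ y → Adj G y s₁ →
           Adj G s₁ x′ → Adj G x′ s₃ → Adj G s₃ y′ → Adj G y′ s₂ →
           s₁ ≢ s₂ → s₁ ≢ s₃ → s₂ ≢ s₃ → x ≢ y → x ≢ s₃ → y ≢ s₃ →
           y′ ≢ s₁ → y′ ≢ x → y′ ≢ y → x′ ≢ x → x′ ≢ s₂ → x′ ≢ y → ⊥
    no-θ {s₁} {s₂} {s₃} {x} {y} {x′} {y′} s₁x xs₂ s₂y ys₁ s₁x′ x′s₃ s₃y′ y′s₂
         s₁≢s₂ s₁≢s₃ s₂≢s₃ x≢y x≢s₃ y≢s₃ y′≢s₁ y′≢x y′≢y x′≢x x′≢s₂ x′≢y =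
      ¬Inside distinct inside
      where
      s₁≢x = adj⇒≢ s₁x
      x≢s₂ = adj⇒≢ xs₂
      s₂≢y = adj⇒≢ s₂y
      y≢s₁ = adj⇒≢ ys₁
      side = edge-on-one-side
      inside : Inside (p s₁) (p x) (p s₂) (p y) (p s₃)
      inside = record
        { ab-convex = side s₁x s₂y (s₁≢s₂ ∘ sym) (x≢s₂ ∘ sym) y≢s₁ (x≢y ∘ sym)
        ; ab-inside = ⇔.trans (side s₁x (adj-sym y′s₂) (s₁≢s₂ ∘ sym) (x≢s₂ ∘ sym) y′≢s₁ y′≢x)
                              (side s₁x (adj-sym s₃y′) y′≢s₁ y′≢x (s₁≢s₃ ∘ sym) (x≢s₃ ∘ sym))
        ; bc-convex = side xs₂ ys₁ (x≢y ∘ sym) (s₂≢y ∘ sym) s₁≢x s₁≢s₂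
        ; bc-inside = ⇔.trans (side xs₂ ys₁ (x≢y ∘ sym) (s₂≢y ∘ sym) s₁≢x s₁≢s₂)
                              (⇔.trans (side xs₂ s₁x′ s₁≢x s₁≢s₂ x′≢x x′≢s₂)
                                       (side xs₂ x′s₃ x′≢x x′≢s₂ (x≢s₃ ∘ sym) (s₂≢s₃ ∘ sym)))
        ; cd-convex = side s₂y s₁x s₁≢s₂ (y≢s₁ ∘ sym) x≢s₂ x≢y
        ; cd-inside = ⇔.trans (side s₂y s₁x′ s₁≢s₂ (y≢s₁ ∘ sym) x′≢s₂ x′≢y)
                              (side s₂y x′s₃ x′≢s₂ x′≢y (s₂≢s₃ ∘ sym) (y≢s₃ ∘ sym))
        ; da-convex = side ys₁ xs₂ x≢y (s₁≢x ∘ sym) s₂≢y (s₁≢s₂ ∘ sym)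
        ; da-inside = ⇔.trans (side ys₁ xs₂ x≢y (s₁≢x ∘ sym) s₂≢y (s₁≢s₂ ∘ sym))
                              (⇔.trans (side ys₁ (adj-sym y′s₂) s₂≢y (s₁≢s₂ ∘ sym) y′≢y y′≢s₁)
                                       (side ys₁ (adj-sym s₃y′) y′≢y y′≢s₁ (y≢s₃ ∘ sym) (s₁≢s₃ ∘ sym)))
        }
      distinct : Distinct5 (p s₁) (p x) (p s₂) (p y) (p s₃)
      distinct = p-≢ s₁≢x , p-≢ s₁≢s₂ , p-≢ (y≢s₁ ∘ sym) , p-≢ s₁≢s₃ , p-≢ x≢s₂ ,
                 p-≢ x≢y , p-≢ x≢s₃ , p-≢ s₂≢y , p-≢ s₂≢s₃ , p-≢ y≢s₃

    neighbour-between : ∀ {a b z t} → Adj G a b → Btw a b z → Adj G z t → t ≢ a → t ≢ b → Btw a b t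
    neighbour-between ab (inj₁ (a<z , z<b)) zt t≢a t≢b = inj₁ (neighbour-inside ab a<z z<b zt t≢a t≢b)
    neighbour-between ab (inj₂ (b<z , z<a)) zt t≢a t≢b = inj₂ (neighbour-inside (adj-sym ab) b<z z<a zt t≢b t≢a)

    private
      ordered-pair : ∀ {P : Fin n → Set} z {u v} → P u → P v → u ≢ v →
                     (p z < p u × p z < p v) ⊎ (p u < p z × p v < p z) → ∃ λ x → ∃ λ y → P x × P y × Btw z y x
      ordered-pair z {u} {v} Pu Pv u≢v sides with ≢⇒<⊎> (p-≢ u≢v) | sides
      ... | inj₁ u<v | inj₁ (z<u , _) = u , v , Pu , Pv , inj₁ (z<u , u<v)
      ... | inj₂ v<u | inj₁ (_ , z<v) = v , u , Pv , Pu , inj₁ (z<v , v<u)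
      ... | inj₁ u<v | inj₂ (_ , v<z) = v , u , Pv , Pu , inj₂ (u<v , v<z)
      ... | inj₂ v<u | inj₂ (u<z , _) = u , v , Pu , Pv , inj₂ (v<u , u<z)

    two-on-one-side : ∀ {P : Fin n → Set} z {b₁ b₂ b₃} → P b₁ → P b₂ → P b₃ → b₁ ≢ b₂ → b₁ ≢ b₃ → b₂ ≢ b₃ →
                      b₁ ≢ z → b₂ ≢ z → b₃ ≢ z → ∃ λ x → ∃ λ y → P x × P y × Btw z y x
    two-on-one-side z P₁ P₂ P₃ b₁≢b₂ b₁≢b₃ b₂≢b₃ b₁≢z b₂≢z b₃≢z
      with ≢⇒<⊎> (p-≢ b₁≢z) | ≢⇒<⊎> (p-≢ b₂≢z) | ≢⇒<⊎> (p-≢ b₃≢z)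
    ... | inj₁ b₁<z | inj₁ b₂<z | _         = ordered-pair z P₁ P₂ b₁≢b₂ (inj₂ (b₁<z , b₂<z))
    ... | inj₂ z<b₁ | inj₂ z<b₂ | _         = ordered-pair z P₁ P₂ b₁≢b₂ (inj₁ (z<b₁ , z<b₂))
    ... | inj₁ b₁<z | inj₂ _    | inj₁ b₃<z = ordered-pair z P₁ P₃ b₁≢b₃ (inj₂ (b₁<z , b₃<z))
    ... | inj₂ z<b₁ | inj₁ _    | inj₂ z<b₃ = ordered-pair z P₁ P₃ b₁≢b₃ (inj₁ (z<b₁ , z<b₃))
    ... | inj₁ _    | inj₂ z<b₂ | inj₂ z<b₃ = ordered-pair z P₂ P₃ b₂≢b₃ (inj₁ (z<b₂ , z<b₃))
    ... | inj₂ _    | inj₁ b₂<z | inj₁ b₃<z = ordered-pair z P₂ P₃ b₂≢b₃ (inj₂ (b₂<z , b₃<z))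

    degreeIn : (Fin n → Bool) → Fin n → ℕ
    degreeIn T x = count (λ t → T t ∧ Graph.E G x t)

    Shared : (Fin n → Bool) → Fin n → Bool
    Shared T x = not (T x) ∧ (2 ≤ᵇ degreeIn T x)

    shared-elim : ∀ {T x} → Shared T x ≡ true → T x ≡ false × 2 ≤ degreeIn T x
    shared-elim h = let ¬Tx , 2≤deg = ∧-elim h in not-elim ¬Tx , ≤ᵇ-elim 2≤deg

    sharedDegree : (Fin n → Bool) → Fin n → ℕ
    sharedDegree T s = count (λ q → Shared T q ∧ Graph.E G s q)

    private
      shrink-above : ∀ {lo z hi y d} → lo < z → z ≤ hi → y ≤ hi → hi ∸ lo ≤ suc d → y ∸ z ≤ d
      shrink-above {lo} {z} {hi} {y} lo<z z≤hi y≤hi span =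
        ≤-pred (≤-trans (s≤s (∸-monoˡ-≤ z y≤hi)) (≤-trans (∸-monoʳ-< lo<z z≤hi) span))

      shrink-below : ∀ {lo z hi y d} → lo ≤ y → z < hi → lo ≤ z → hi ∸ lo ≤ suc d → z ∸ y ≤ d
      shrink-below {lo} {z} {hi} {y} lo≤y z<hi lo≤z span =
        ≤-pred (≤-trans (s≤s (∸-monoʳ-≤ z lo≤y)) (≤-trans (∸-monoˡ-< z<hi lo≤z) span))

    -- If every vertex of T had three shared neighbours, chords from T-vertices to shared vertices
    -- would nest forever.
    module _ (T : Fin n → Bool) (dense : ∀ s → T s ≡ true → 3 ≤ sharedDegree T s) where

      private
        SharedNeighbour : Fin n → Fin n → Set
        SharedNeighbour z q = (Shared T q ∧ Graph.E G z q) ≡ true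

        shared-pair-on-one-side : ∀ {z} → T z ≡ true →
                                  ∃ λ x → ∃ λ y → SharedNeighbour z x × SharedNeighbour z y × Btw z y x
        shared-pair-on-one-side {z} Tz =
          let _ , _ , _ , b₁≢b₂ , b₁≢b₃ , b₂≢b₃ , h₁ , h₂ , h₃ = ≥3⇒three _ (dense z Tz)
          in two-on-one-side z h₁ h₂ h₃ b₁≢b₂ b₁≢b₃ b₂≢b₃ (≢z h₁) (≢z h₂) (≢z h₃)
          where
          ≢z : ∀ {q} → SharedNeighbour z q → q ≢ z
          ≢z h = adj⇒≢ (proj₂ (∧-elim h)) ∘ sym

        nested-chord : ∀ {z} → T z ≡ true → ∃ λ y → ∃ λ t → Adj G z y × T t ≡ true × Btw z y t
        nested-chord {z} Tz =
          let x , y , hx , hy , x∈zy = shared-pair-on-one-side Tz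
              x-shared , _  = ∧-elim hx
              y-shared , zy = ∧-elim hy
              t , h , t≢z   = ≥2⇒other (λ t → T t ∧ Graph.E G x t) (proj₂ (shared-elim x-shared)) z
              Tt , xt       = ∧-elim h
              t≢y : t ≢ _
              t≢y = distinguishes T Tt (proj₁ (shared-elim y-shared))
          in y , t , zy , Tt , neighbour-between zy x∈zy xt t≢z t≢y

        descend : ∀ d {lo hi z} → p hi ∸ p lo ≤ d → Adj G lo hi → p lo < p z → p z < p hi → T z ≡ true → ⊥
        descend zero span _ lo<z z<hi _ = <⇒≱ (m<n⇒0<n∸m (<-trans lo<z z<hi)) span
        descend (suc d) {lo} {hi} {z} span lo-hi lo<z z<hi Tz = continue (nested-chord Tz)
          where
          y-within : ∀ {y} → Adj G z y → p lo ≤ p y × p y ≤ p hi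
          y-within = neighbour-within lo-hi (<-trans lo<z z<hi) lo<z z<hi
          continue : (∃ λ y → ∃ λ t → Adj G z y × T t ≡ true × Btw z y t) → ⊥
          continue (y , t , zy , Tt , inj₁ (z<t , t<y)) =
            descend d (shrink-above lo<z (<⇒≤ z<hi) (proj₂ (y-within zy)) span) zy z<t t<y Tt
          continue (y , t , zy , Tt , inj₂ (y<t , t<z)) =
            descend d (shrink-below (proj₁ (y-within zy)) z<hi (<⇒≤ lo<z) span) (adj-sym zy) y<t t<z Tt

      dense⇒empty : ∀ {s} → T s ≡ true → ⊥
      dense⇒empty {s} Ts = start (nested-chord Ts)
        where
        start : (∃ λ y → ∃ λ t → Adj G s y × T t ≡ true × Btw s y t) → ⊥
        start (y , t , sy , Tt , inj₁ (s<t , t<y)) = descend _ ≤-refl sy s<t t<y Tt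
        start (y , t , sy , Tt , inj₂ (y<t , t<s)) = descend _ ≤-refl (adj-sym sy) y<t t<s Tt

    low-shared-degree : ∀ T {s₀} → T s₀ ≡ true → ∃ λ s → T s ≡ true × sharedDegree T s ≤ 2
    low-shared-degree T Ts₀ = [ found , (λ none → ⊥-elim (dense⇒empty T (dense none) Ts₀)) ]′ (search low)
      where
      low : Fin n → Bool
      low s = T s ∧ (sharedDegree T s ≤ᵇ 2)
      found : (∃ λ s → low s ≡ true) → ∃ λ s → T s ≡ true × sharedDegree T s ≤ 2
      found (s , h) = s , proj₁ (∧-elim h) , ≤ᵇ-elim (proj₂ (∧-elim h))
      dense : (∀ s → low s ≡ false) → ∀ s → T s ≡ true → 3 ≤ sharedDegree T s
      dense none s Ts = ≰⇒> (λ ≤2 → distinguishes low (∧-intro Ts (≤ᵇ-intro ≤2)) (none s) refl)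

    private
      degree-without : ∀ T {s q} → Graph.E G q s ≡ false → degreeIn (T without s) q ≡ degreeIn T q
      degree-without T {s} {q} ¬qs = count-cong same
        where
        same : ∀ t → ((T t ∧ not (t == s)) ∧ Graph.E G q t) ≡ (T t ∧ Graph.E G q t)
        same t with t ≟ s
        ... | yes refl rewrite ¬qs | ∧-zeroʳ (T t) = refl
        ... | no _     rewrite ∧-identityʳ (T t) = refl

      survives-removal : ∀ T {s q} → (Shared T q ∧ not (Graph.E G s q)) ≡ true → Shared (T without s) q ≡ true
      survives-removal T {s} {q} h =
        let q-shared , ¬sq = ∧-elim h
            ¬Tq , 2≤deg    = shared-elim q-shared
        in ∧-intro (not-intro (cong (_∧ not (q == s)) ¬Tq))
                   (≤ᵇ-intro (subst (2 ≤_) (sym (degree-without T (trans (Graph.sym G q s) (not-elim ¬sq)))) 2≤deg))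

      bound-step : ∀ {a b x} → a ≤ 2 + b → b + 2 ≤ 2 * x → a + 2 ≤ 2 * suc x
      bound-step {a} {b} {x} a≤2+b b+2≤2x = begin
        a + 2          ≤⟨ +-monoˡ-≤ 2 a≤2+b ⟩
        2 + b + 2      ≡⟨ +-assoc 2 b 2 ⟩
        2 + (b + 2)    ≤⟨ +-monoʳ-≤ 2 b+2≤2x ⟩
        2 + 2 * x      ≡⟨ *-suc 2 x ⟨
        2 * suc x      ∎
        where open ≤-Reasoning

    -- Removing a vertex s of T with at most two shared neighbours destroys at most two shared vertices.
    shared-bound : ∀ c T → count T ≡ suc c → count (Shared T) + 2 ≤ 2 * count T
    shared-bound zero T #T≡1 = subst₂ (λ a m → a + 2 ≤ 2 * m) (sym (count-none none)) (sym #T≡1) ≤-refl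
      where
      none : ∀ x → Shared T x ≡ false
      none x with Shared T x in x-shared
      ... | false = refl
      ... | true  = ⊥-elim (<⇒≱ (≤-trans (proj₂ (shared-elim x-shared)) (count-mono neighbours⊆T)) (≤-reflexive #T≡1))
        where
        neighbours⊆T : ∀ t → (T t ∧ Graph.E G x t) ≡ true → T t ≡ true
        neighbours⊆T t = proj₁ ∘ ∧-elim
    shared-bound (suc c) T #T≡ = remove (proj₂ (low-shared-degree T (proj₂ (≥1⇒∈ T (subst (1 ≤_) (sym #T≡) (s≤s z≤n))))))
      where
      remove : ∀ {s} → T s ≡ true × sharedDegree T s ≤ 2 → count (Shared T) + 2 ≤ 2 * count T
      remove {s} (Ts , low) =
        subst (λ m → count (Shared T) + 2 ≤ 2 * m) (sym (count-remove T Ts))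
              (bound-step removed (shared-bound c (T without s) (suc-injective (trans (sym (count-remove T Ts)) #T≡))))
        where
        removed : count (Shared T) ≤ 2 + count (Shared (T without s))
        removed = ≤-trans (≤-reflexive (count-split (Shared T) (Graph.E G s)))
                          (+-mono-≤ low (count-mono (λ q → survives-removal T {s} {q})))

module GkGraph where

  open import Defs
    using ( Graph; Adj; Dominating; SecureDominating; GkV; c; vv; w; u; GkEdge; c-w; v-w; v-u; u-u; GkAdj
          ; SpanningSubgraph; IsoToGk; ContainsSpanningGk )
  open Counting
  open import Data.Nat using (ℕ; zero; suc; _+_)
  open import Data.Nat.Properties using (+-comm)
  open import Data.Fin using (Fin; zero; suc; _≟_)
  open import Data.Fin.Subset using (Subset; _∈_; _∉_; _∪_; _-_; ⁅_⁆; ∣_∣)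
  open import Data.Fin.Subset.Properties using (x∈p∪q⁺; x∈⁅x⁆; x∈p∧x≢y⇒x∈p-y)
  open import Data.Vec using (lookup; tabulate)
  open import Data.Vec.Properties using (lookup∘tabulate; lookup⇒[]=)
  open import Data.Bool using (Bool; true; false)
  open import Data.Product using (∃; _×_; _,_)
  open import Data.Sum using (inj₁; inj₂) renaming (swap to flip)
  open import Data.Empty using (⊥-elim)
  open import Function using (_∘_)
  open import Function.Bundles using (_↔_; _⇔_; Inverse; mk⇔)
  open import Relation.Nullary using (¬_; Dec; yes; no; does; _⊎-dec_)
  open import Relation.Nullary.Decidable using (map′; dec-true; dec-false; does-⇔)
  open import Relation.Binary.PropositionalEquality

  private
    variable
      k n : ℕ

  gkEdge? : (x y : GkV k) → Dec (GkEdge x y)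
  gkEdge? c        c           = no λ ()
  gkEdge? c        (vv _)      = no λ ()
  gkEdge? c        (w i j)     = yes (c-w i j)
  gkEdge? c        (u _ _)     = no λ ()
  gkEdge? (vv _)   c           = no λ ()
  gkEdge? (vv _)   (vv _)      = no λ ()
  gkEdge? (vv i)   (w i′ j)    = map′ (λ { refl → v-w i j }) (λ { (v-w _ _) → refl }) (i ≟ i′)
  gkEdge? (vv i)   (u i′ j)    = map′ (λ { refl → v-u i j }) (λ { (v-u _ _) → refl }) (i ≟ i′)
  gkEdge? (w _ _)  _           = no λ ()
  gkEdge? (u _ _)  c           = no λ ()
  gkEdge? (u _ _)  (vv _)      = no λ ()
  gkEdge? (u _ _)  (w _ _)     = no λ ()
  gkEdge? (u _ zero) (u _ zero) = no λ ()
  gkEdge? (u i zero) (u i′ (suc zero)) = map′ (λ { refl → u-u i }) (λ { (u-u _) → refl }) (i ≟ i′)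
  gkEdge? (u _ (suc zero)) (u _ _) = no λ ()

  gkAdj? : (x y : GkV k) → Dec (GkAdj x y)
  gkAdj? x y = gkEdge? x y ⊎-dec gkEdge? y x

  gkEdge-irrefl : {x : GkV k} → ¬ GkEdge x x
  gkEdge-irrefl ()

  does-true⇒ : ∀ {A : Set} (a? : Dec A) → does a? ≡ true → A
  does-true⇒ (yes a) _ = a

  module GkEmbedding (G : Graph n) (F : GkV k ↔ Fin n)
                     (edge : ∀ {x y} → GkEdge x y → Adj G (Inverse.to F x) (Inverse.to F y)) where

    open Inverse F using () renaming (to to f; from to g; strictlyInverseˡ to f∘g; strictlyInverseʳ to g∘f)

    H : Graph n
    H = record
      { E   = λ a b → does (gkAdj? (g a) (g b))
      ; sym = λ a b → does-⇔ (mk⇔ flip flip) (gkAdj? (g a) (g b)) (gkAdj? (g b) (g a))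
      ; irr = λ a → dec-false (gkAdj? (g a) (g a)) λ { (inj₁ e) → gkEdge-irrefl e ; (inj₂ e) → gkEdge-irrefl e }
      }

    H≅Gk : IsoToGk H k
    H≅Gk = F , λ x y → subst₂ (λ x′ y′ → GkAdj x y ⇔ (does (gkAdj? x′ y′) ≡ true)) (sym (g∘f x)) (sym (g∘f y))
                         (mk⇔ (dec-true (gkAdj? x y)) (does-true⇒ (gkAdj? x y)))

    H⊆G : SpanningSubgraph H G
    H⊆G a b Hab with does-true⇒ (gkAdj? (g a) (g b)) Hab
    ... | inj₁ e = subst₂ (Adj G) (f∘g a) (f∘g b) (edge e)
    ... | inj₂ e = subst₂ (Adj G) (f∘g a) (f∘g b) (trans (Graph.sym G _ _) (edge e))

    contains-Gk : ContainsSpanningGk G k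
    contains-Gk = H , H⊆G , H≅Gk

    f-injective : ∀ {x y} → f x ≡ f y → x ≡ y
    f-injective {x} {y} fx≡fy = trans (sym (g∘f x)) (trans (cong g fx≡fy) (g∘f y))

    at-vertices : ∀ {P : Fin n → Set} → (∀ x → P (f x)) → ∀ z → P z
    at-vertices {P} P∘f z = subst P (f∘g z) (P∘f (g z))

    edge′ : ∀ {x y} → GkEdge x y → Adj G (f y) (f x)
    edge′ e = trans (Graph.sym G _ _) (edge e)

    isHub : GkV k → Bool
    isHub c        = true
    isHub (vv _)   = true
    isHub (w _ _)  = false
    isHub (u _ _)  = false

    D : Subset n
    D = tabulate (isHub ∘ g)

    lookup-D : ∀ x → lookup D (f x) ≡ isHub x
    lookup-D x = trans (lookup∘tabulate (isHub ∘ g) (f x)) (cong isHub (g∘f x))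

    hub∈D : ∀ {x} → isHub x ≡ true → f x ∈ D
    hub∈D {x} h = lookup⇒[]= (f x) D (trans (lookup-D x) h)

    hubs : Fin (suc k) → Fin n
    hubs zero    = f c
    hubs (suc i) = f (vv i)

    hubs-enumerate : Enumerates (isHub ∘ g) hubs
    hubs-enumerate = record { injective = injective ; inside = inside ; onto = onto }
      where
      injective : ∀ {i j} → hubs i ≡ hubs j → i ≡ j
      injective {zero}  {zero}  _  = refl
      injective {zero}  {suc _} eq with () ← f-injective eq
      injective {suc _} {zero}  eq with () ← f-injective eq
      injective {suc _} {suc _} eq with refl ← f-injective eq = refl
      inside : ∀ i → isHub (g (hubs i)) ≡ true
      inside zero    = cong isHub (g∘f c)
      inside (suc i) = cong isHub (g∘f (vv i))
      onto : ∀ z → isHub (g z) ≡ true → ∃ λ i → hubs i ≡ z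
      onto = at-vertices {P = λ z → isHub (g z) ≡ true → ∃ λ i → hubs i ≡ z} onto-f
        where
        onto-f : ∀ x → isHub (g (f x)) ≡ true → ∃ λ i → hubs i ≡ f x
        onto-f c      _ = zero , refl
        onto-f (vv i) _ = suc i , refl
        onto-f (w i j) h with () ← trans (sym (cong isHub (g∘f (w i j)))) h
        onto-f (u i j) h with () ← trans (sym (cong isHub (g∘f (u i j)))) h

    ∣D∣ : ∣ D ∣ ≡ k + 1
    ∣D∣ = trans (∣ D ∣≡count) (trans (count-cong (lookup∘tabulate (isHub ∘ g)))
                  (trans (Enumerates⇒count≡ (isHub ∘ g) hubs-enumerate) (+-comm 1 k)))

    private
      enters : ∀ {v y} → y ∈ (D - v) ∪ ⁅ y ⁆
      enters {y = y} = x∈p∪q⁺ (inj₂ (x∈⁅x⁆ y))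

      hub-stays : ∀ {x v y} → isHub x ≡ true → f x ≢ v → f x ∈ (D - v) ∪ ⁅ y ⁆
      hub-stays h fx≢v = x∈p∪q⁺ (inj₁ (x∈p∧x≢y⇒x∈p-y (hub∈D h) fx≢v))

      f-≢ : ∀ {x y} → x ≢ y → f x ≢ f y
      f-≢ x≢y = x≢y ∘ f-injective

    D-dominating : Dominating G D
    D-dominating = at-vertices dominated
      where
      dominated : ∀ x → f x ∉ D → ∃ λ t → t ∈ D × Adj G (f x) t
      dominated c        fx∉D = ⊥-elim (fx∉D (hub∈D refl))
      dominated (vv _)   fx∉D = ⊥-elim (fx∉D (hub∈D refl))
      dominated (w i j)  _    = f c , hub∈D refl , edge′ (c-w i j)
      dominated (u i j)  _    = f (vv i) , hub∈D refl , edge′ (v-u i j)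

    swap-centre : ∀ i j → Dominating G ((D - f c) ∪ ⁅ f (w i j) ⁆)
    swap-centre i j = at-vertices dominated
      where
      dominated : ∀ x → f x ∉ (D - f c) ∪ ⁅ f (w i j) ⁆ → ∃ λ t → t ∈ (D - f c) ∪ ⁅ f (w i j) ⁆ × Adj G (f x) t
      dominated c         _   = f (w i j) , enters , edge (c-w i j)
      dominated (vv i′)   fx∉ = ⊥-elim (fx∉ (hub-stays refl (f-≢ λ ())))
      dominated (w i′ j′) _   = f (vv i′) , hub-stays refl (f-≢ λ ()) , edge′ (v-w i′ j′)
      dominated (u i′ j′) _   = f (vv i′) , hub-stays refl (f-≢ λ ()) , edge′ (v-u i′ j′)

    swap-hub : ∀ i j → Dominating G ((D - f (vv i)) ∪ ⁅ f (u i j) ⁆)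
    swap-hub i j = at-vertices dominated
      where
      D′ = (D - f (vv i)) ∪ ⁅ f (u i j) ⁆
      dominated : ∀ x → f x ∉ D′ → ∃ λ t → t ∈ D′ × Adj G (f x) t
      dominated c         fx∉ = ⊥-elim (fx∉ (hub-stays refl (f-≢ λ ())))
      dominated (w i′ j′) _   = f c , hub-stays refl (f-≢ λ ()) , edge′ (c-w i′ j′)
      dominated (vv i′)   fx∉ with i′ ≟ i
      ... | yes refl = f (u i j) , enters , edge (v-u i j)
      ... | no i′≢i  = ⊥-elim (fx∉ (hub-stays refl (f-≢ λ { refl → i′≢i refl })))
      dominated (u i′ j′) fx∉ with i′ ≟ i
      ... | no i′≢i  = f (vv i′) , hub-stays refl (f-≢ λ { refl → i′≢i refl }) , edge′ (v-u i′ j′)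
      ... | yes refl with j′ ≟ j
      ...   | yes refl = ⊥-elim (fx∉ enters)
      ...   | no j′≢j  = f (u i j) , enters , twins j′≢j
        where
        twins : ∀ {j j′} → j′ ≢ j → Adj G (f (u i j′)) (f (u i j))
        twins {zero}      {zero}      j′≢j = ⊥-elim (j′≢j refl)
        twins {zero}      {suc zero}  _    = edge′ (u-u i)
        twins {suc zero}  {zero}      _    = edge (u-u i)
        twins {suc zero}  {suc zero}  j′≢j = ⊥-elim (j′≢j refl)

    D-secure : SecureDominating G D
    D-secure = D-dominating , at-vertices defended
      where
      defended : ∀ x → f x ∉ D → ∃ λ v → v ∈ D × Adj G (f x) v × Dominating G ((D - v) ∪ ⁅ f x ⁆)
      defended c        fx∉D = ⊥-elim (fx∉D (hub∈D refl))
      defended (vv _)   fx∉D = ⊥-elim (fx∉D (hub∈D refl))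
      defended (w i j)  _    = f c , hub∈D refl , edge′ (c-w i j) , swap-centre i j
      defended (u i j)  _    = f (vv i) , hub∈D refl , edge′ (v-u i j) , swap-hub i j

module SecureDomination where

  open import Defs using (Graph; Adj; SecureDominating; GkV; c; vv; u; w; GkEdge; c-w; v-w; v-u; u-u; ContainsSpanningGk)
  open Counting
  open OuterplanarDrawing
  open GkGraph
  open import Data.Nat using (ℕ; zero; suc; _+_; _*_; _≤_; _≤ᵇ_; z≤n; s≤s)
  open import Data.Nat.Properties hiding (_≟_)
  open import Data.Nat.Solver using (module +-*-Solver)
  open import Data.Fin using (Fin; zero; suc; _≟_)
  open import Data.Fin.Subset using (Subset; _∈_; _∉_; _∪_; _-_; ⁅_⁆; ∣_∣)
  open import Data.Fin.Subset.Properties using (x∈p∪q⁻; p─q⊆p; x∈⁅y⁆⇒x≡y)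
  open import Data.Vec using (_∷_; lookup; there)
  open import Data.Vec.Properties using ([]=⇒lookup)
  open import Data.Bool as Bool using (Bool; true; false; not; _∧_; if_then_else_)
  open import Data.Bool.Properties using (∧-zeroʳ; ¬-not)
  open import Algebra.Properties.Semiring.Sum +-*-semiring using (sum; sum-cong-≗; ∑-comm; ∑-distrib-+)
  open import Data.Product using (Σ; ∃; _×_; _,_; proj₁; proj₂)
  open import Data.Sum using (inj₁; inj₂; [_,_]′)
  open import Data.Empty using (⊥; ⊥-elim)
  open import Function using (_∘_; case_of_)
  open import Function.Bundles using (_↔_; mk↔ₛ′)
  open import Function.Definitions using (Injective)
  open import Relation.Nullary using (yes; no)
  open import Relation.Binary.PropositionalEquality

  +2≤2*suc⇒≤2* : ∀ {m k} → m + 2 ≤ 2 * suc k → m ≤ 2 * k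
  +2≤2*suc⇒≤2* {m} {k} m+2≤ = +-cancelʳ-≤ 2 m (2 * k) (subst (m + 2 ≤_) (trans (*-suc 2 k) (+-comm 2 (2 * k))) m+2≤)

  -- x and y count the unshared and shared vertices, b the dominating vertices with exactly one private neighbour.
  all-own-privates-arithmetic : ∀ {k x y b} → 2 ≤ k → x + y ≡ 4 * k → x + b ≡ 2 * suc k →
                                y + 2 ≤ 2 * suc k → y ≤ 2 * b → k ≡ 2 × b ≡ 2 × y ≡ 4
  all-own-privates-arithmetic {k} {x} {y} {b} 2≤k x+y x+b y+2≤ y≤2b = k≡2 , b≡2 , trans y≡2+b (cong (2 +_) b≡2)
    where
    open +-*-Solver
    open ≤-Reasoning
    balance : y + 2 * suc k ≡ 4 * k + b
    balance = begin-equality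
      y + 2 * suc k  ≡⟨ cong (y +_) x+b ⟨
      y + (x + b)    ≡⟨ solve 3 (λ y x b → y :+ (x :+ b) := (x :+ y) :+ b) refl y x b ⟩
      (x + y) + b    ≡⟨ cong (_+ b) x+y ⟩
      4 * k + b       ∎
    b≤2 : b ≤ 2
    b≤2 = +-cancelˡ-≤ (4 * k) b 2 (begin
      4 * k + b          ≡⟨ balance ⟨
      y + 2 * suc k     ≤⟨ +-monoˡ-≤ (2 * suc k) (+2≤2*suc⇒≤2* y+2≤) ⟩
      2 * k + 2 * suc k  ≡⟨ solve 1 (λ k → con 2 :* k :+ con 2 :* (con 1 :+ k) := con 4 :* k :+ con 2) refl k ⟩
      4 * k + 2          ∎)
    k≤2 : k ≤ 2
    k≤2 = *-cancelˡ-≤ 2 (+-cancelˡ-≤ (2 * k + b) (2 * k) 4 (begin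
      (2 * k + b) + 2 * k    ≡⟨ solve 2 (λ k b → (con 2 :* k :+ b) :+ con 2 :* k := con 4 :* k :+ b) refl k b ⟩
      4 * k + b              ≡⟨ balance ⟨
      y + 2 * suc k         ≤⟨ +-monoˡ-≤ (2 * suc k) y≤2b ⟩
      2 * b + 2 * suc k      ≡⟨ solve 2 (λ k b → con 2 :* b :+ con 2 :* (con 1 :+ k) := (con 2 :* k :+ b) :+ (b :+ con 2)) refl k b ⟩
      (2 * k + b) + (b + 2)  ≤⟨ +-monoʳ-≤ (2 * k + b) (+-monoˡ-≤ 2 b≤2) ⟩
      (2 * k + b) + 4        ∎))
    k≡2 : k ≡ 2
    k≡2 = ≤-antisym k≤2 2≤k
    y≡2+b : y ≡ 2 + b
    y≡2+b = +-cancelʳ-≡ 6 y (2 + b) (begin-equality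
      y + 6       ≡⟨ subst (λ k → y + 2 * suc k ≡ 4 * k + b) k≡2 balance ⟩
      8 + b        ≡⟨ solve 1 (λ b → con 8 :+ b := (con 2 :+ b) :+ con 6) refl b ⟩
      (2 + b) + 6  ∎)
    b≡2 : b ≡ 2
    b≡2 = pinned b≤2 (subst (_≤ 2 * b) y≡2+b y≤2b)
      where
      pinned : ∀ {b} → b ≤ 2 → 2 + b ≤ 2 * b → b ≡ 2
      pinned {2} _ _ = refl
      pinned {0} _ ()
      pinned {1} _ (s≤s (s≤s ()))
      pinned {suc (suc (suc _))} (s≤s (s≤s ())) _

  one-without-privates-arithmetic : ∀ {k x y} → x + y ≡ 4 * k → y + 2 ≤ 2 * suc k → x ≤ 2 * k →
                                    x ≡ 2 * k × y ≡ 2 * k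
  one-without-privates-arithmetic {k} {x} {y} x+y y+2≤ x≤2k = x≡2k , y≡2k
    where
    open +-*-Solver
    2k+2k≡x+y : 2 * k + 2 * k ≡ x + y
    2k+2k≡x+y = trans (solve 1 (λ k → con 2 :* k :+ con 2 :* k := con 4 :* k) refl k) (sym x+y)
    x≡2k : x ≡ 2 * k
    x≡2k = ≤-antisym x≤2k (+-cancelʳ-≤ (2 * k) (2 * k) x
             (≤-trans (≤-reflexive 2k+2k≡x+y) (+-monoʳ-≤ x (+2≤2*suc⇒≤2* y+2≤))))
    y≡2k : y ≡ 2 * k
    y≡2k = +-cancelˡ-≡ (2 * k) y (2 * k) (trans (cong (_+ y) (sym x≡2k)) (sym 2k+2k≡x+y))

  x∉p-x : ∀ {n} (D : Subset n) (x : Fin n) → x ∉ D - x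
  x∉p-x (_ ∷ D) Fin.zero ()
  x∉p-x (_ ∷ D) (Fin.suc x) (there x∈D-x) = x∉p-x D x x∈D-x

  module SecureDominatingSet {n} (G : Graph n) (p : Fin n → ℕ) (p-injective : Injective _≡_ _≡_ p)
                             (no-crossing : NonCrossing G p) (D : Subset n) (secure : SecureDominating G D) where

    open NonCrossingDrawing G p p-injective no-crossing

    S : Fin n → Bool
    S = lookup D

    ∈⇒S : ∀ {x} → x ∈ D → S x ≡ true
    ∈⇒S = []=⇒lookup

    ¬S⇒∉ : ∀ {x} → S x ≡ false → x ∉ D
    ¬S⇒∉ ¬Sx x∈D with () ← trans (sym (∈⇒S x∈D)) ¬Sx

    dominated : ∀ {y} → S y ≡ false → 1 ≤ degreeIn S y
    dominated {y} ¬Sy with proj₁ secure y (¬S⇒∉ ¬Sy)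
    ... | v , v∈D , yv = ∈⇒≥1 (λ t → S t ∧ Graph.E G y t) (∧-intro (∈⇒S v∈D) yv)

    Unshared : Fin n → Bool
    Unshared y = not (S y) ∧ (degreeIn S y ≤ᵇ 1)

    unshared : ∀ {y} → S y ≡ false → Shared S y ≡ false → Unshared y ≡ true
    unshared {y} ¬Sy ¬shared = ∧-intro (not-intro ¬Sy) (≤ᵇ-intro (≤-pred (≤ᵇ-false {2} {degreeIn S y} 2≰deg)))
      where
      2≰deg : (2 ≤ᵇ degreeIn S y) ≡ false
      2≰deg = subst (λ b → (not b ∧ (2 ≤ᵇ degreeIn S y)) ≡ false) ¬Sy ¬shared

    unshared-elim : ∀ {y} → Unshared y ≡ true → S y ≡ false × degreeIn S y ≤ 1
    unshared-elim {y} h = not-elim (proj₁ (∧-elim {not (S y)} h)) , ≤ᵇ-elim (proj₂ (∧-elim {not (S y)} h))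

    PrivateOf : Fin n → Fin n → Bool
    PrivateOf s y = S s ∧ (Unshared y ∧ Graph.E G s y)

    privates : Fin n → ℕ
    privates s = count (PrivateOf s)

    record Private (s y : Fin n) : Set where
      field
        owner    : S s ≡ true
        outside  : S y ≡ false
        adjacent : Adj G s y
        lonely   : degreeIn S y ≤ 1

    private-elim : ∀ {s y} → PrivateOf s y ≡ true → Private s y
    private-elim {s} {y} h =
      let Ss , h′          = ∧-elim {S s} h
          unshared , sy    = ∧-elim {Unshared y} h′
          ¬Sy , deg≤1      = unshared-elim unshared
      in record { owner = Ss ; outside = ¬Sy ; adjacent = sy ; lonely = deg≤1 }

    private-unique : ∀ {s y t} → PrivateOf s y ≡ true → S t ≡ true → Adj G y t → t ≡ s
    private-unique {s} {y} {t} h St yt with t ≟ s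
    ... | yes t≡s = t≡s
    ... | no t≢s  = ⊥-elim (≤⇒≯ lonely (two⇒≥2 (λ t → S t ∧ Graph.E G y t) t≢s (∧-intro St yt) (∧-intro owner (adj-sym adjacent))))
      where open Private (private-elim h)

    private-intro : ∀ {v y} → S v ≡ true → Adj G y v → Unshared y ≡ true → PrivateOf v y ≡ true
    private-intro Sv yv unshared = ∧-intro Sv (∧-intro unshared (adj-sym yv))

    shared-not-private : ∀ {s y} → PrivateOf s y ≡ true → Shared S y ≡ true → ⊥
    shared-not-private h y-shared = ≤⇒≯ (Private.lonely (private-elim h)) (proj₂ (shared-elim y-shared))

    record Defender (x v : Fin n) : Set where
      field
        member   : S v ≡ true
        adjacent : Adj G x v
        covers   : ∀ {y} → PrivateOf v y ≡ true → y ≢ x → Adj G y x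

    -- The vertices that only v dominates must be dominated by x once x replaces v.
    defender-exists : ∀ {x} → S x ≡ false → ∃ (Defender x)
    defender-exists {x} ¬Sx with proj₂ secure x (¬S⇒∉ ¬Sx)
    ... | v , v∈D , xv , swap-dominating =
      v , record { member = ∈⇒S v∈D ; adjacent = xv ; covers = covers }
      where
      covers : ∀ {y} → PrivateOf v y ≡ true → y ≢ x → Adj G y x
      covers {y} h y≢x with swap-dominating y y∉
        where
        open Private (private-elim h)
        y∉ : y ∉ (D - v) ∪ ⁅ x ⁆
        y∉ y∈ with x∈p∪q⁻ (D - v) ⁅ x ⁆ y∈
        ... | inj₁ y∈D-v = ¬S⇒∉ outside (p─q⊆p D ⁅ v ⁆ y∈D-v)
        ... | inj₂ y∈x   = y≢x (x∈⁅y⁆⇒x≡y x y∈x)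
      ... | z , z∈ , yz with x∈p∪q⁻ (D - v) ⁅ x ⁆ z∈
      ...   | inj₂ z∈x   = subst (Adj G y) (x∈⁅y⁆⇒x≡y x z∈x) yz
      ...   | inj₁ z∈D-v with private-unique h (∈⇒S (p─q⊆p D ⁅ v ⁆ z∈D-v)) yz
      ...     | refl = ⊥-elim (x∉p-x D z z∈D-v)

    private
      choose-defender : ∀ x b → S x ≡ b → Fin n
      choose-defender x true  _   = x
      choose-defender x false ¬Sx = proj₁ (defender-exists ¬Sx)

      choose-defender-spec : ∀ x b (Sx≡b : S x ≡ b) → b ≡ false → Defender x (choose-defender x b Sx≡b)
      choose-defender-spec x false ¬Sx _ = proj₂ (defender-exists ¬Sx)

    -- A vertex of S is its own defender; only the defenders of shared vertices matter.
    defender : Fin n → Fin n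
    defender x = choose-defender x (S x) refl

    defender-spec : ∀ {x} → S x ≡ false → Defender x (defender x)
    defender-spec {x} = choose-defender-spec x (S x) refl

    privates-adjacent : ∀ {s a b} → PrivateOf s a ≡ true → PrivateOf s b ≡ true → a ≢ b → Adj G a b
    privates-adjacent {s} {a} {b} ha hb a≢b with defender-exists (Private.outside (private-elim ha))
    ... | v , record { member = Sv ; adjacent = av ; covers = covers } with private-unique ha Sv av
    ...   | refl = adj-sym (covers hb (a≢b ∘ sym))

    privates≤2 : ∀ s → privates s ≤ 2
    privates≤2 s = NoThree⇒≤2 (PrivateOf s) λ a≢b a≢c b≢c ha hb hc →
      no-K₄ (adjacent ha) (adjacent hb , privates-adjacent ha hb a≢b) (adjacent hc , privates-adjacent ha hc a≢c)
            (privates-adjacent hb hc b≢c)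
      where
      adjacent : ∀ {y} → PrivateOf s y ≡ true → Adj G s y
      adjacent = Private.adjacent ∘ private-elim

    module _ {x v} (x-shared : Shared S x ≡ true) (v-defends : Defender x v) where

      open Defender v-defends

      defender-private-adjacent : ∀ {a} → PrivateOf v a ≡ true → Adj G a v × Adj G a x
      defender-private-adjacent ha =
        adj-sym (Private.adjacent (private-elim ha)) , covers ha (λ { refl → shared-not-private ha x-shared })

      defender-privates≤1 : ∀ {a b} → PrivateOf v a ≡ true → PrivateOf v b ≡ true → a ≢ b → ⊥
      defender-privates≤1 ha hb a≢b =
        no-K₄ (Private.adjacent (private-elim ha)) (Private.adjacent (private-elim hb) , privates-adjacent ha hb a≢b)
              (adj-sym adjacent , proj₂ (defender-private-adjacent ha)) (proj₂ (defender-private-adjacent hb))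

    DefendedBy : Fin n → Fin n → Bool
    DefendedBy s x = Shared S x ∧ (defender x == s)

    defended : Fin n → ℕ
    defended s = count (DefendedBy s)

    defended-elim : ∀ {s x} → DefendedBy s x ≡ true → Shared S x ≡ true × Defender x s
    defended-elim {s} {x} h =
      let x-shared , dx≡s = ∧-elim {Shared S x} h
      in x-shared , subst (Defender x) (==-sound dx≡s) (defender-spec (proj₁ (shared-elim x-shared)))

    defended≤2 : ∀ {s a} → PrivateOf s a ≡ true → defended s ≤ 2
    defended≤2 {s} {a} ha = NoThree⇒≤2 (DefendedBy s) λ x≢y x≢z y≢z hx hy hz →
      no-K₂₃ s≢a (common hx) (common hy) (common hz) x≢y x≢z y≢z
      where
      s≢a : s ≢ a
      s≢a = adj⇒≢ (Private.adjacent (private-elim ha))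
      common : ∀ {x} → DefendedBy s x ≡ true → Common s a x
      common h with defended-elim h
      ... | x-shared , s-defends =
        adj-sym (Defender.adjacent s-defends) , proj₂ (defender-private-adjacent x-shared s-defends ha)

    two-privates⇒defended≡0 : ∀ {s a b} → PrivateOf s a ≡ true → PrivateOf s b ≡ true → a ≢ b → defended s ≡ 0
    two-privates⇒defended≡0 {s} ha hb a≢b = count-none {P = DefendedBy s} λ x → ¬-not λ h →
      let x-shared , s-defends = defended-elim h in defender-privates≤1 x-shared s-defends ha hb a≢b

    outsider-defends-nothing : ∀ {s} → S s ≡ false → defended s ≡ 0
    outsider-defends-nothing {s} ¬Ss = count-none {P = DefendedBy s} λ x → ¬-not λ h →
      distinguishes S (Defender.member (proj₂ (defended-elim h))) ¬Ss refl

    defended-adjacent : ∀ {s x} → DefendedBy s x ≡ true → Adj G x s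
    defended-adjacent = Defender.adjacent ∘ proj₂ ∘ defended-elim

    defended⇒¬S : ∀ {s x} → DefendedBy s x ≡ true → S x ≡ false
    defended⇒¬S = proj₁ ∘ shared-elim ∘ proj₁ ∘ defended-elim

    defended-by-distinct : ∀ {s s′ x x′} → DefendedBy s x ≡ true → DefendedBy s′ x′ ≡ true → s ≢ s′ → x ≢ x′
    defended-by-distinct {s} {s′} {x} hx hx′ s≢s′ refl =
      s≢s′ (trans (sym (==-sound {x = defender x} (proj₂ (∧-elim {Shared S x} hx))))
                  (==-sound {x = defender x} (proj₂ (∧-elim {Shared S x} hx′))))

    -- Otherwise s, its private a and t would be three common neighbours of x₁ and x₂.
    no-common-third : ∀ {s a x₁ x₂ t} → PrivateOf s a ≡ true → DefendedBy s x₁ ≡ true → DefendedBy s x₂ ≡ true →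
                      x₁ ≢ x₂ → S t ≡ true → Adj G x₁ t → Adj G x₂ t → t ≢ s → ⊥
    no-common-third {s} {a} ha h₁ h₂ x₁≢x₂ St x₁t x₂t t≢s =
      no-K₂₃ x₁≢x₂ (defended-adjacent h₁ , defended-adjacent h₂) (private-adjacent h₁ , private-adjacent h₂) (x₁t , x₂t)
             (distinguishes S (Private.owner (private-elim ha)) (Private.outside (private-elim ha)))
             (t≢s ∘ sym) (distinguishes S St (Private.outside (private-elim ha)) ∘ sym)
      where
      private-adjacent : ∀ {x} → DefendedBy s x ≡ true → Adj G x a
      private-adjacent h = let x-shared , s-defends = defended-elim h
                           in adj-sym (proj₂ (defender-private-adjacent x-shared s-defends ha))

    outside-split : count (not ∘ S) ≡ count Unshared + count (Shared S)
    outside-split = trans (count-split (not ∘ S) (λ x → degreeIn S x ≤ᵇ 1))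
                          (cong (count Unshared +_) (count-cong (λ x → cong (not (S x) ∧_) (not-≤ᵇ1 (degreeIn S x)))))
      where
      not-≤ᵇ1 : ∀ m → not (m ≤ᵇ 1) ≡ (2 ≤ᵇ m)
      not-≤ᵇ1 zero          = refl
      not-≤ᵇ1 (suc zero)    = refl
      not-≤ᵇ1 (suc (suc m)) = refl

    ∑privates≡#unshared : sum privates ≡ count Unshared
    ∑privates≡#unshared = trans (∑-comm (λ s y → ind (PrivateOf s y))) (sum-cong-≗ owners)
      where
      owners : ∀ y → sum (λ s → ind (PrivateOf s y)) ≡ ind (Unshared y)
      owners y with Unshared y in unshared
      ... | false = sum-zero (λ s → cong ind (∧-zeroʳ (S s)))
      ... | true  = trans (count-cong (λ s → cong (S s ∧_) (Graph.sym G s y)))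
                          (≤-antisym (proj₂ (unshared-elim unshared)) (dominated (proj₁ (unshared-elim unshared))))

    ∑defended≡#shared : sum defended ≡ count (Shared S)
    ∑defended≡#shared = count-fibres (Shared S) defender

    outsider-has-no-privates : ∀ {s} → S s ≡ false → privates s ≡ 0
    outsider-has-no-privates {s} ¬Ss = count-none {P = PrivateOf s} (λ y → cong (_∧ (Unshared y ∧ Graph.E G s y)) ¬Ss)

    module AllOwnPrivates (k : ℕ) (2≤k : 2 ≤ k) (#S : count S ≡ suc k) (#outside : count (not ∘ S) ≡ 4 * k)
                          (owns-private : ∀ {s} → S s ≡ true → 1 ≤ privates s) where

      OnePrivate : Fin n → Bool
      OnePrivate s = S s ∧ (privates s ≤ᵇ 1)

      privates+one≡2 : ∀ s → privates s + ind (OnePrivate s) ≡ 2 * ind (S s)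
      privates+one≡2 s = one-or-two (S s) (privates s) owns-private (privates≤2 s) (outsider-has-no-privates {s})
        where
        one-or-two : ∀ b m → (b ≡ true → 1 ≤ m) → m ≤ 2 → (b ≡ false → m ≡ 0) → m + ind (b ∧ (m ≤ᵇ 1)) ≡ 2 * ind b
        one-or-two false m _ _ m≡0 = cong (_+ 0) (m≡0 refl)
        one-or-two true 1 _ _ _ = refl
        one-or-two true 2 _ _ _ = refl
        one-or-two true 0 1≤m _ _ with () ← 1≤m refl
        one-or-two true (suc (suc (suc _))) _ (s≤s (s≤s ())) _

      defended≤ : ∀ s → defended s ≤ 2 * ind (OnePrivate s)
      defended≤ s with privates s ≤? 1 | S s Bool.≟ true
      ... | no ≰1 | _ =
        let _ , _ , a≢b , ha , hb = ≥2⇒two (PrivateOf s) (≰⇒> ≰1)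
        in ≤-trans (≤-reflexive (two-privates⇒defended≡0 ha hb a≢b)) z≤n
      ... | yes _ | no ¬Ss = ≤-trans (≤-reflexive (outsider-defends-nothing (¬-not ¬Ss))) z≤n
      ... | yes ≤1 | yes Ss = subst (λ b → defended s ≤ 2 * ind b) (sym (∧-intro Ss (≤ᵇ-intro ≤1)))
                                    (defended≤2 (proj₂ (≥1⇒∈ (PrivateOf s) (owns-private Ss))))

      counts : k ≡ 2 × count OnePrivate ≡ 2 × count (Shared S) ≡ 4
      counts = all-own-privates-arithmetic 2≤k
        (trans (sym outside-split) #outside)
        (begin-equality
          count Unshared + count OnePrivate               ≡⟨ cong (_+ count OnePrivate) ∑privates≡#unshared ⟨
          sum privates + count OnePrivate                 ≡⟨ ∑-distrib-+ privates (ind ∘ OnePrivate) ⟨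
          sum (λ s → privates s + ind (OnePrivate s))     ≡⟨ sum-cong-≗ privates+one≡2 ⟩
          sum (λ s → 2 * ind (S s))                       ≡⟨ count-scale 2 S #S ⟩
          2 * suc k                                       ∎)
        (subst (λ m → count (Shared S) + 2 ≤ 2 * m) #S (shared-bound k S #S))
        (begin
          count (Shared S)                                ≡⟨ ∑defended≡#shared ⟨
          sum defended                                    ≤⟨ sum-mono-≤ defended≤ ⟩
          sum (λ s → 2 * ind (OnePrivate s))              ≡⟨ count-scale 2 OnePrivate refl ⟩
          2 * count OnePrivate                            ∎)
        where open ≤-Reasoning

      defends-two : ∀ {s} → OnePrivate s ≡ true → defended s ≡ 2
      defends-two = sum-tight-at 2 OnePrivate defended≤ (begin
        2 * count OnePrivate    ≡⟨ cong (2 *_) (proj₁ (proj₂ counts)) ⟩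
        4                       ≡⟨ proj₂ (proj₂ counts) ⟨
        count (Shared S)        ≡⟨ ∑defended≡#shared ⟨
        sum defended            ∎)
        where open ≤-Reasoning

      #S-without : ∀ {s} → S s ≡ true → count (S without s) ≡ 2
      #S-without Ss = suc-injective (trans (sym (count-remove S Ss)) (trans #S (cong suc (proj₁ counts))))

      record Reach (s s′ : Fin n) : Set where
        field
          x x′ t          : Fin n
          x-defended      : DefendedBy s x ≡ true
          x′-defended     : DefendedBy s x′ ≡ true
          x≢x′            : x ≢ x′
          x-adjacent      : Adj G x s′
          x′-adjacent     : Adj G x′ t
          t∈S             : S t ≡ true
          t≢s             : t ≢ s
          t≢s′            : t ≢ s′

      -- The two vertices defended by s have distinct second S-neighbours, which are then the other
      -- two vertices of S.
      reach : ∀ {s s′} → OnePrivate s ≡ true → S s′ ≡ true → s′ ≢ s → Reach s s′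
      reach {s} {s′} one Ss′ s′≢s =
        let Ss , _                      = ∧-elim {S s} one
            _ , ha                      = ≥1⇒∈ (PrivateOf s) (owns-private Ss)
            x₁ , x₂ , x₁≢x₂ , h₁ , h₂   = ≥2⇒two (DefendedBy s) (≤-reflexive (sym (defends-two one)))
            t₁ , St₁ , x₁t₁ , t₁≢s      = second-neighbour h₁
            t₂ , St₂ , x₂t₂ , t₂≢s      = second-neighbour h₂
            t₁≢t₂ : t₁ ≢ t₂
            t₁≢t₂ = λ t₁≡t₂ → no-common-third ha h₁ h₂ x₁≢x₂ St₁ x₁t₁ (subst (Adj G _) (sym t₁≡t₂) x₂t₂) t₁≢s
        in choose Ss h₁ h₂ x₁≢x₂ St₁ x₁t₁ t₁≢s St₂ x₂t₂ t₂≢s t₁≢t₂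
        where
        second-neighbour : ∀ {x} → DefendedBy s x ≡ true → ∃ λ t → S t ≡ true × Adj G x t × t ≢ s
        second-neighbour {x} h =
          let t , h′ , t≢s = ≥2⇒other (λ t → S t ∧ Graph.E G x t) (proj₂ (shared-elim (proj₁ (defended-elim h)))) s
          in t , proj₁ (∧-elim {S t} h′) , proj₂ (∧-elim {S t} h′) , t≢s
        choose : ∀ {x₁ x₂ t₁ t₂} → S s ≡ true → DefendedBy s x₁ ≡ true → DefendedBy s x₂ ≡ true → x₁ ≢ x₂ →
                 S t₁ ≡ true → Adj G x₁ t₁ → t₁ ≢ s → S t₂ ≡ true → Adj G x₂ t₂ → t₂ ≢ s → t₁ ≢ t₂ → Reach s s′
        choose {x₁} {x₂} {t₁} {t₂} Ss h₁ h₂ x₁≢x₂ St₁ x₁t₁ t₁≢s St₂ x₂t₂ t₂≢s t₁≢t₂ with s′ ≟ t₁ | s′ ≟ t₂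
        ... | yes refl | _ = record
          { x = x₁ ; x′ = x₂ ; t = t₂ ; x-defended = h₁ ; x′-defended = h₂ ; x≢x′ = x₁≢x₂
          ; x-adjacent = x₁t₁ ; x′-adjacent = x₂t₂ ; t∈S = St₂ ; t≢s = t₂≢s ; t≢s′ = t₁≢t₂ ∘ sym }
        ... | no _ | yes refl = record
          { x = x₂ ; x′ = x₁ ; t = t₁ ; x-defended = h₂ ; x′-defended = h₁ ; x≢x′ = x₁≢x₂ ∘ sym
          ; x-adjacent = x₂t₂ ; x′-adjacent = x₁t₁ ; t∈S = St₁ ; t≢s = t₁≢s ; t≢s′ = t₁≢t₂ }
        ... | no s′≢t₁ | no s′≢t₂ = ⊥-elim (≤2⇒NoThree (S without s) (≤-reflexive (#S-without Ss)) s′≢t₁ s′≢t₂ t₁≢t₂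
                                     (without-∈ {P = S} Ss′ s′≢s) (without-∈ {P = S} St₁ t₁≢s) (without-∈ {P = S} St₂ t₂≢s))

      private
        reaches⇒θ : ∀ {s₁ s₂} → s₁ ≢ s₂ → S s₁ ≡ true → S s₂ ≡ true → Reach s₁ s₂ → Reach s₂ s₁ → ⊥
        reaches⇒θ {s₁} {s₂} s₁≢s₂ Ss₁ Ss₂
          (record { x = X ; x′ = X′ ; t = t ; x-defended = dX ; x′-defended = dX′ ; x≢x′ = X≢X′
                  ; x-adjacent = Xs₂ ; x′-adjacent = X′t ; t∈S = St ; t≢s = t≢s₁ ; t≢s′ = t≢s₂ })
          (record { x = Y ; x′ = Y′ ; t = t′ ; x-defended = dY ; x′-defended = dY′ ; x≢x′ = Y≢Y′
                  ; x-adjacent = Ys₁ ; x′-adjacent = Y′t′ ; t∈S = St′ ; t≢s = t′≢s₂ ; t≢s′ = t′≢s₁ })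
          with t ≟ t′
        ... | no t≢t′ = ≤2⇒NoThree (S without s₁) (≤-reflexive (#S-without Ss₁)) (t≢s₂ ∘ sym) (t′≢s₂ ∘ sym) t≢t′
                         (without-∈ {P = S} Ss₂ (s₁≢s₂ ∘ sym)) (without-∈ {P = S} St t≢s₁) (without-∈ {P = S} St′ t′≢s₁)
        ... | yes refl =
          no-θ (adj-sym (defended-adjacent dX)) Xs₂ (adj-sym (defended-adjacent dY)) Ys₁
               (adj-sym (defended-adjacent dX′)) X′t (adj-sym Y′t′) (defended-adjacent dY′)
               s₁≢s₂ (t≢s₁ ∘ sym) (t≢s₂ ∘ sym)
               (defended-by-distinct dX dY s₁≢s₂) (outside-≢ dX St) (outside-≢ dY St)
               (outside-≢ dY′ Ss₁) (defended-by-distinct dY′ dX (s₁≢s₂ ∘ sym)) (Y≢Y′ ∘ sym)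
               (X≢X′ ∘ sym) (outside-≢ dX′ Ss₂) (defended-by-distinct dX′ dY s₁≢s₂)
          where
          outside-≢ : ∀ {s x v} → DefendedBy s x ≡ true → S v ≡ true → x ≢ v
          outside-≢ dx Sv = distinguishes S Sv (defended⇒¬S dx) ∘ sym

      impossible : ⊥
      impossible =
        let s₁ , s₂ , s₁≢s₂ , one₁ , one₂ = ≥2⇒two OnePrivate (≤-reflexive (sym (proj₁ (proj₂ counts))))
            Ss₁ = proj₁ (∧-elim {S s₁} one₁)
            Ss₂ = proj₁ (∧-elim {S s₂} one₂)
        in reaches⇒θ s₁≢s₂ Ss₁ Ss₂ (reach one₁ Ss₂ (s₁≢s₂ ∘ sym)) (reach one₂ Ss₁ s₁≢s₂)

    module OneWithoutPrivates (k : ℕ) (#S : count S ≡ suc k) (#outside : count (not ∘ S) ≡ 4 * k)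
                              {s₀ : Fin n} (Ss₀ : S s₀ ≡ true) (no-private : privates s₀ ≡ 0) where

      Rest : Fin n → Bool
      Rest = S without s₀

      #Rest : count Rest ≡ k
      #Rest = suc-injective (trans (sym (count-remove S Ss₀)) #S)

      privates≤ : ∀ t → privates t ≤ 2 * ind (Rest t)
      privates≤ t with t ≟ s₀ | S t Bool.≟ true
      ... | yes refl | _      = ≤-trans (≤-reflexive no-private) z≤n
      ... | no _     | no ¬St = ≤-trans (≤-reflexive (outsider-has-no-privates (¬-not ¬St))) z≤n
      ... | no _     | yes St = subst (λ b → privates t ≤ 2 * ind (b ∧ true)) (sym St) (privates≤2 t)

      counts : count Unshared ≡ 2 * k × count (Shared S) ≡ 2 * k
      counts = one-without-privates-arithmetic
        (trans (sym outside-split) #outside)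
        (subst (λ m → count (Shared S) + 2 ≤ 2 * m) #S (shared-bound k S #S))
        (begin
          count Unshared                 ≡⟨ ∑privates≡#unshared ⟨
          sum privates                   ≤⟨ sum-mono-≤ privates≤ ⟩
          sum (λ t → 2 * ind (Rest t))   ≡⟨ count-scale 2 Rest #Rest ⟩
          2 * k                          ∎)
        where open ≤-Reasoning

      two-privates : ∀ {t} → Rest t ≡ true → privates t ≡ 2
      two-privates = sum-tight-at 2 Rest privates≤
        (≤-reflexive (trans (cong (2 *_) #Rest) (trans (sym (proj₁ counts)) (sym ∑privates≡#unshared))))

      defended-by-s₀ : ∀ {x} → Shared S x ≡ true → defender x ≡ s₀
      defended-by-s₀ {x} x-shared with defender x ≟ s₀
      ... | yes d≡s₀ = d≡s₀
      ... | no d≢s₀ =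
        let _ , _ , a≢b , ha , hb = ≥2⇒two (PrivateOf (defender x)) (≤-reflexive (sym (two-privates (without-∈ {P = S} Sd d≢s₀))))
        in ⊥-elim (defender-privates≤1 x-shared (defender-spec ¬Sx) ha hb a≢b)
        where
        ¬Sx = proj₁ (shared-elim x-shared)
        Sd = Defender.member (defender-spec ¬Sx)

      shared-adjacent-s₀ : ∀ {x} → Shared S x ≡ true → Adj G x s₀
      shared-adjacent-s₀ x-shared =
        subst (Adj G _) (defended-by-s₀ x-shared) (Defender.adjacent (defender-spec (proj₁ (shared-elim x-shared))))

      second : Fin n → Fin n
      second x with search (λ t → Rest t ∧ Graph.E G x t)
      ... | inj₁ (t , _) = t
      ... | inj₂ _       = s₀

      second-spec : ∀ {x} → Shared S x ≡ true → Rest (second x) ≡ true × Adj G x (second x)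
      second-spec {x} x-shared with search (λ t → Rest t ∧ Graph.E G x t)
      ... | inj₁ (t , h) = ∧-elim {Rest t} h
      ... | inj₂ none =
        let t , h , t≢s₀ = ≥2⇒other (λ t → S t ∧ Graph.E G x t) (proj₂ (shared-elim x-shared)) s₀
            St , xt      = ∧-elim {S t} h
        in ⊥-elim (distinguishes (λ t → Rest t ∧ Graph.E G x t) (∧-intro (without-∈ {P = S} St t≢s₀) xt) (none t) refl)

      SecondIs : Fin n → Fin n → Bool
      SecondIs t x = Shared S x ∧ (second x == t)

      second-elim : ∀ {t x} → SecondIs t x ≡ true → Shared S x ≡ true × second x ≡ t
      second-elim {t} {x} h = let x-shared , eq = ∧-elim {Shared S x} h in x-shared , ==-sound {x = second x} eq

      second-count≤ : ∀ t → count (SecondIs t) ≤ 2 * ind (Rest t)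
      second-count≤ t with Rest t Bool.≟ true
      ... | no ¬Rt = ≤-trans (≤-reflexive (count-none {P = SecondIs t} λ x → ¬-not λ h →
                       let x-shared , eq = second-elim h in ¬Rt (subst (λ t → Rest t ≡ true) eq (proj₁ (second-spec x-shared)))))
                       z≤n
      ... | yes Rt = subst (λ b → count (SecondIs t) ≤ 2 * ind b) (sym Rt)
                       (NoThree⇒≤2 (SecondIs t) λ x≢y x≢z y≢z hx hy hz →
                         no-K₂₃ (without-≢ {P = S} Rt ∘ sym) (common hx) (common hy) (common hz) x≢y x≢z y≢z)
        where
        common : ∀ {x} → SecondIs t x ≡ true → Common s₀ t x
        common h = let x-shared , eq = second-elim h
                   in adj-sym (shared-adjacent-s₀ x-shared) , adj-sym (subst (Adj G _) eq (proj₂ (second-spec x-shared)))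

      second-count≡ : ∀ {t} → Rest t ≡ true → count (SecondIs t) ≡ 2
      second-count≡ = sum-tight-at 2 Rest second-count≤
        (≤-reflexive (trans (cong (2 *_) #Rest) (trans (sym (proj₂ counts)) (sym (count-fibres (Shared S) second)))))

      private
        hubs : Σ (Fin k → Fin n) (Enumerates Rest)
        hubs = count≡⇒enumeration Rest #Rest

        hub : Fin k → Fin n
        hub = proj₁ hubs

        module Hubs = Enumerates (proj₂ hubs)

        leaves : (i : Fin k) → Σ (Fin 2 → Fin n) (Enumerates (PrivateOf (hub i)))
        leaves i = count≡⇒enumeration (PrivateOf (hub i)) (two-privates (Hubs.inside i))

        links : (i : Fin k) → Σ (Fin 2 → Fin n) (Enumerates (SecondIs (hub i)))
        links i = count≡⇒enumeration (SecondIs (hub i)) (second-count≡ (Hubs.inside i))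

      embed : GkV k → Fin n
      embed c       = s₀
      embed (vv i)  = hub i
      embed (u i j) = proj₁ (leaves i) j
      embed (w i j) = proj₁ (links i) j

      hub∈S : ∀ i → S (hub i) ≡ true
      hub∈S i = without-⊆ {P = S} (Hubs.inside i)

      leaf-private : ∀ i j → PrivateOf (hub i) (embed (u i j)) ≡ true
      leaf-private i = Enumerates.inside (proj₂ (leaves i))

      link-second : ∀ i j → SecondIs (hub i) (embed (w i j)) ≡ true
      link-second i = Enumerates.inside (proj₂ (links i))

      link-shared : ∀ i j → Shared S (embed (w i j)) ≡ true
      link-shared i j = proj₁ (second-elim (link-second i j))

      data Kind : Set where
        kind-c kind-v kind-u kind-w : Kind

      kind : GkV k → Kind
      kind c       = kind-c
      kind (vv _)  = kind-v
      kind (u _ _) = kind-u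
      kind (w _ _) = kind-w

      classify : Fin n → Kind
      classify z = if S z then (if z == s₀ then kind-c else kind-v) else (if Shared S z then kind-w else kind-u)

      private
        classify-by : ∀ {z} b → S z ≡ b →
                      classify z ≡ (if b then (if z == s₀ then kind-c else kind-v) else (if Shared S z then kind-w else kind-u))
        classify-by {z} _ = cong λ b → if b then (if z == s₀ then kind-c else kind-v) else (if Shared S z then kind-w else kind-u)

      classify-embed : ∀ x → classify (embed x) ≡ kind x
      classify-embed c = trans (classify-by true Ss₀) (cong (λ b → if b then kind-c else kind-v) (==-refl s₀))
      classify-embed (vv i) = trans (classify-by true (hub∈S i))
                                    (cong (λ b → if b then kind-c else kind-v) (==-≢ (without-≢ {P = S} (Hubs.inside i))))
      classify-embed (u i j) = trans (classify-by false (Private.outside (private-elim (leaf-private i j))))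
                                     (cong (λ b → if b then kind-w else kind-u) (¬-not (shared-not-private (leaf-private i j))))
      classify-embed (w i j) = trans (classify-by false (proj₁ (shared-elim (link-shared i j))))
                                     (cong (λ b → if b then kind-w else kind-u) (link-shared i j))

      leaf-owner : ∀ {i j i′ j′} → embed (u i j) ≡ embed (u i′ j′) → i ≡ i′
      leaf-owner {i} {j} {i′} {j′} eq = sym (Hubs.injective (private-unique (leaf-private i j) (hub∈S i′) owner-adjacent))
        where
        owner-adjacent : Adj G (embed (u i j)) (hub i′)
        owner-adjacent = subst (λ z → Adj G z (hub i′)) (sym eq) (adj-sym (Private.adjacent (private-elim (leaf-private i′ j′))))

      link-owner : ∀ {i j i′ j′} → embed (w i j) ≡ embed (w i′ j′) → i ≡ i′
      link-owner {i} {j} {i′} {j′} eq = Hubs.injective (trans (sym (second-of i j)) (trans (cong second eq) (second-of i′ j′)))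
        where
        second-of : ∀ i j → second (embed (w i j)) ≡ hub i
        second-of i j = proj₂ (second-elim (link-second i j))

      embed-injective : ∀ {x y} → embed x ≡ embed y → x ≡ y
      embed-injective {x} {y} eq = by-kind x y (trans (sym (classify-embed x)) (trans (cong classify eq) (classify-embed y))) eq
        where
        by-kind : ∀ x y → kind x ≡ kind y → embed x ≡ embed y → x ≡ y
        by-kind c       c         _ _  = refl
        by-kind (vv i)  (vv i′)   _ eq = cong vv (Hubs.injective eq)
        by-kind (u i j) (u i′ j′) _ eq = cong₂ u (leaf-owner eq)
          (Enumerates.injective (proj₂ (leaves i)) (trans eq (cong (λ i → embed (u i j′)) (sym (leaf-owner eq)))))
        by-kind (w i j) (w i′ j′) _ eq = cong₂ w (link-owner eq)
          (Enumerates.injective (proj₂ (links i)) (trans eq (cong (λ i → embed (w i j′)) (sym (link-owner eq)))))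
        by-kind c       (vv _)    () _
        by-kind c       (u _ _)   () _
        by-kind c       (w _ _)   () _
        by-kind (vv _)  c         () _
        by-kind (vv _)  (u _ _)   () _
        by-kind (vv _)  (w _ _)   () _
        by-kind (u _ _) c         () _
        by-kind (u _ _) (vv _)    () _
        by-kind (u _ _) (w _ _)   () _
        by-kind (w _ _) c         () _
        by-kind (w _ _) (vv _)    () _
        by-kind (w _ _) (u _ _)   () _

      embed-onto : ∀ z → ∃ λ x → embed x ≡ z
      embed-onto z with S z Bool.≟ true | z ≟ s₀ | Shared S z Bool.≟ true
      ... | yes _  | yes refl | _ = c , refl
      ... | yes Sz | no z≢s₀  | _ = let i , eq = Hubs.onto z (without-∈ {P = S} Sz z≢s₀) in vv i , eq
      ... | no ¬Sz | _ | yes z-shared =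
        let i , hub≡second = Hubs.onto (second z) (proj₁ (second-spec z-shared))
            j , eq = Enumerates.onto (proj₂ (links i)) z
                       (∧-intro z-shared (subst (λ t → (second z == t) ≡ true) (sym hub≡second) (==-refl (second z))))
        in w i j , eq
      ... | no ¬Sz | _ | no ¬shared =
        let v , v∈D , zv = proj₁ secure z (¬S⇒∉ (¬-not ¬Sz))
            z-private = private-intro (∈⇒S v∈D) zv (unshared (¬-not ¬Sz) (¬-not ¬shared))
            v≢s₀ : v ≢ s₀
            v≢s₀ = λ v≡s₀ → ≤⇒≯ (≤-reflexive no-private) (∈⇒≥1 (PrivateOf s₀) (subst (λ s → PrivateOf s z ≡ true) v≡s₀ z-private))
            i , hub≡v = Hubs.onto v (without-∈ {P = S} (∈⇒S v∈D) v≢s₀)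
            j , eq = Enumerates.onto (proj₂ (leaves i)) z (subst (λ s → PrivateOf s z ≡ true) (sym hub≡v) z-private)
        in u i j , eq

      embedding : GkV k ↔ Fin n
      embedding = mk↔ₛ′ embed (proj₁ ∘ embed-onto) (proj₂ ∘ embed-onto) (λ x → embed-injective (proj₂ (embed-onto (embed x))))

      embed-edge : ∀ {x y} → GkEdge x y → Adj G (embed x) (embed y)
      embed-edge (c-w i j) = adj-sym (shared-adjacent-s₀ (link-shared i j))
      embed-edge (v-w i j) = adj-sym (subst (Adj G _) (proj₂ (second-elim (link-second i j))) (proj₂ (second-spec (link-shared i j))))
      embed-edge (v-u i j) = Private.adjacent (private-elim (leaf-private i j))
      embed-edge (u-u i)   = privates-adjacent (leaf-private i zero) (leaf-private i (suc zero))
                                               (λ eq → case Enumerates.injective (proj₂ (leaves i)) eq of λ ())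

      contains-Gk : ContainsSpanningGk G k
      contains-Gk = GkEmbedding.contains-Gk G embedding embed-edge

    spanning-Gk : ∀ k → 2 ≤ k → n ≡ 5 * k + 1 → ∣ D ∣ ≡ k + 1 → ContainsSpanningGk G k
    spanning-Gk k 2≤k n≡5k+1 ∣D∣ = [ one-without-privates , all-own-privates ]′ (search NoPrivate)
      where
      NoPrivate : Fin n → Bool
      NoPrivate s = S s ∧ (privates s ≤ᵇ 0)
      #S : count S ≡ suc k
      #S = trans (sym ∣ D ∣≡count) (trans ∣D∣ (+-comm k 1))
      #outside : count (not ∘ S) ≡ 4 * k
      #outside = +-cancelˡ-≡ (suc k) (count (not ∘ S)) (4 * k) (begin-equality
        suc k + count (not ∘ S)   ≡⟨ cong (_+ count (not ∘ S)) #S ⟨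
        count S + count (not ∘ S) ≡⟨ count-complement S ⟩
        n                         ≡⟨ n≡5k+1 ⟩
        5 * k + 1                 ≡⟨ solve 1 (λ k → con 5 :* k :+ con 1 := (con 1 :+ k) :+ con 4 :* k) refl k ⟩
        suc k + 4 * k             ∎)
        where open ≤-Reasoning
              open +-*-Solver
      one-without-privates : (∃ λ s → NoPrivate s ≡ true) → ContainsSpanningGk G k
      one-without-privates (s₀ , h) =
        let Ss₀ , none = ∧-elim {S s₀} h
        in OneWithoutPrivates.contains-Gk k #S #outside Ss₀ (n≤0⇒n≡0 (≤ᵇ-elim none))
      all-own-privates : (∀ s → NoPrivate s ≡ false) → ContainsSpanningGk G k
      all-own-privates none = ⊥-elim (AllOwnPrivates.impossible k 2≤k #S #outside owns-private)
        where
        owns-private : ∀ {s} → S s ≡ true → 1 ≤ privates s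
        owns-private {s} Ss = ≰⇒> λ ≤0 → distinguishes NoPrivate (∧-intro Ss (≤ᵇ-intro ≤0)) (none s) refl

open import Defs using (Graph; Outerplanar; SecureDominating; ContainsSpanningGk)
open import Data.Nat using (ℕ; _≤_; _+_; _*_)
open import Data.Fin using (Fin; toℕ)
open import Data.Fin.Properties using (toℕ-injective)
open import Data.Fin.Subset using (Subset; ∣_∣)
open import Data.Product using (∃; _×_; _,_)
open import Data.Sum using (inj₁)
open import Function using (_∘_)
open import Function.Bundles using (_⇔_; mk⇔; Inverse; Injection; Equivalence)
open import Function.Definitions using (Injective)
open import Function.Properties.Inverse using (Inverse⇒Injection)
open import Relation.Binary.PropositionalEquality using (_≡_; refl)
open SecureDomination using (module SecureDominatingSet)
open GkGraph using (module GkEmbedding)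

theorem5 : (k : ℕ) → 2 ≤ k → (G : Graph (5 * k + 1)) → Outerplanar G →
           ((∃ λ (S : Subset (5 * k + 1)) → ∣ S ∣ ≡ k + 1 × SecureDominating G S)
            ⇔ ContainsSpanningGk G k)
theorem5 k 2≤k G (pos , no-crossing) = mk⇔ secure⇒Gk Gk⇒secure
  where
  position : Fin (5 * k + 1) → ℕ
  position = toℕ ∘ Inverse.to pos

  position-injective : Injective _≡_ _≡_ position
  position-injective = Injection.injective (Inverse⇒Injection pos) ∘ toℕ-injective

  secure⇒Gk : (∃ λ (S : Subset (5 * k + 1)) → ∣ S ∣ ≡ k + 1 × SecureDominating G S) → ContainsSpanningGk G k
  secure⇒Gk (D , ∣D∣ , secure) =
    SecureDominatingSet.spanning-Gk G position position-injective no-crossing D secure k 2≤k refl ∣D∣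

  Gk⇒secure : ContainsSpanningGk G k → ∃ λ (S : Subset (5 * k + 1)) → ∣ S ∣ ≡ k + 1 × SecureDominating G S
  Gk⇒secure (H , H⊆G , F , H≅Gk) = D , ∣D∣ , D-secure
    where open GkEmbedding G F (λ e → H⊆G _ _ (Equivalence.to (H≅Gk _ _) (inj₁ e)))
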